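{- Let $d$ be a positive integer and let $\mathrm{CFWF}$ be the procedure described in the context. Then for every pair $(\Lambda,Q)\in Y_d$ and every $\varphi\in\mathrm{Aff}(d,\mathbb Z)$, the pair $(\varphi(\Lambda),\varphi(Q))$ lies in $Y_d$ and $$\mathrm{CFWF}\big(\varphi(\Lambda),\varphi(Q)\big)=\mathrm{CFWF}(\Lambda,Q).$$ In particular the output does not depend on the choice of the matrix $A$ made in the procedure. In other words, $\mathrm{CFWF}$ is a weak canonical form for $Y_d$ with respect to the action of $\mathrm{Aff}(d,\mathbb Z)$: it is constant on each orbit.
   Context: Fix a positive integer $d$. Groups and spans. - $\mathrm{Aff}(d,\mathbb Z)$ denotes the group of maps $x\mapsto Ax+b$ with $A\in GL(d,\mathbb Z)$ and $b\in\mathbb Z^d$. Here $GL(d,\mathbb Z)$ is the group of integer $d\times d$ matrices of determinant $\pm1$. - These maps act on $\mathbb Q^d$, on subsets of $\mathbb Q^d$, and on ordered tuples of points, in each case pointwise. - $\mathrm{Span}$ denotes the affine span over $\mathbb Q$, and "affinely independent" is meant over $\mathbb Q$. Frames. - A frame is a finite ordered tuple of affinely independent points of $\mathbb Q^d$. - For a finite $\Lambda\subseteq\mathbb Z^d$, a frame $Q$ is $\Lambda$-covering if $\Lambda\subseteq\mathrm{Span}(Q)$. - $Y_d$ is the set of pairs $(\Lambda,Q)$ with $\Lambda\subseteq\mathbb Z^d$ finite and $Q$ a $\Lambda$-covering frame. - If $Q=(q_0,\dots,q_m)$ is a frame and $p\in\mathrm{Span}(Q)$, the coordinates of $p$ with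 respect to $Q$ are the unique $(c_1,\dots,c_m)\in\mathbb Q^m$ with $p=q_0+\sum_i c_i(q_i-q_0)$. Hermite normal form. For an integer $d\times k$ matrix $M$, $\mathrm{HNF}(M)$ denotes its Hermite normal form. This is the canonical representative of the orbit of $M$ under left multiplication by $GL(d,\mathbb Z)$, so $\mathrm{HNF}(BM)=\mathrm{HNF}(M)$ for all $B\in GL(d,\mathbb Z)$. There exists $A\in GL(d,\mathbb Z)$ with $AM=\mathrm{HNF}(M)$. The procedure $\mathrm{CFWF}(\Lambda,Q)$, for $(\Lambda,Q)\in Y_d$: 1. Let $T$ be the list of those points of $Q$ that lie in $\Lambda$, ordered as in $Q$. Let $k=\dim\mathrm{Span}(\Lambda)$. 2. While $T$ has fewer than $k+1$ points, append to $T$ the point of $\Lambda\setminus\mathrm{Span}(T)$ whose coordinates with respect to $Q$ are lexicographically minimal. 3. Write $T=(p_0,\dots,p_k)$. Let $M$ be the $d\times k$ integer matrix with columns $p_1-p_0,\dots,p_k-p_0$. Choose any $A\in GL(d,\mathbb Z)$ with $AM=\mathrm{HNF}(M)$, and let $\psi(x)=A(x-p_0)$. 4. Return the pair $(\psi(\Lambda),\psi(T))$. -}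

module Defs where

open import Data.Nat as ℕ using (ℕ; zero; suc)
open import Data.Integer as ℤ using (ℤ)
open import Data.Rational as ℚ using (ℚ)
open import Data.Fin using (Fin; zero; suc; toℕ; punchIn; inject≤) renaming (_<_ to _<F_)
open import Data.Vec as V using (Vec; []; _∷_; lookup; tabulate; zipWith; replicate)
open import Data.List as L using (List; []; _∷_; length; map)
open import Data.List.Membership.Propositional using (_∈_)
open import Data.List.Relation.Unary.All using (All)
open import Data.Product using (Σ; ∃; _×_; _,_)
open import Data.Sum using (_⊎_)
open import Data.Unit using (⊤)
open import Data.Empty using (⊥)
open import Relation.Nullary using (¬_)
open import Relation.Binary.PropositionalEquality using (_≡_)

-- Points: ℤ^d and ℚ^d as vectors (so that _≡_ is the right equality)

ZPt : ℕ → Set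
ZPt d = Vec ℤ d

QPt : ℕ → Set
QPt d = Vec ℚ d

emb : ∀ {d} → ZPt d → QPt d
emb = V.map (ℚ._/ 1)

Mat : ℕ → ℕ → Set
Mat m n = Fin m → Fin n → ℤ

sumFin : ∀ n → (Fin n → ℤ) → ℤ
sumFin zero    f = ℤ.0ℤ
sumFin (suc n) f = f zero ℤ.+ sumFin n (λ i → f (suc i))

sumFinℚ : ∀ n → (Fin n → ℚ) → ℚ
sumFinℚ zero    f = ℚ.0ℚ
sumFinℚ (suc n) f = f zero ℚ.+ sumFinℚ n (λ i → f (suc i))

_·M_ : ∀ {a b c} → Mat a b → Mat b c → Mat a c
_·M_ {b = b} A B i j = sumFin b (λ l → A i l ℤ.* B l j)

sgn : ∀ {n} → Fin n → ℤ
sgn zero          = ℤ.1ℤ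
sgn (suc zero)    = ℤ.-1ℤ
sgn (suc (suc j)) = sgn j

det : ∀ n → Mat n n → ℤ
det zero    M = ℤ.1ℤ
det (suc n) M =
  sumFin (suc n) (λ j → sgn j ℤ.* (M zero j ℤ.* det n (λ r c → M (suc r) (punchIn j c))))

InGL : ∀ d → Mat d d → Set
InGL d A = (det d A ≡ ℤ.1ℤ) ⊎ (det d A ≡ ℤ.-1ℤ)

_·ℤ_ : ∀ {d} → Mat d d → ZPt d → ZPt d
_·ℤ_ {d} A x = tabulate (λ i → sumFin d (λ j → A i j ℤ.* lookup x j))

_·ℚ_ : ∀ {d} → Mat d d → QPt d → QPt d
_·ℚ_ {d} A x = tabulate (λ i → sumFinℚ d (λ j → (A i j ℚ./ 1) ℚ.* lookup x j))

record Aff (d : ℕ) : Set where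
  field
    A    : Mat d d
    A∈GL : InGL d A
    b    : ZPt d

actℤ : ∀ {d} → Aff d → ZPt d → ZPt d
actℤ φ x = zipWith ℤ._+_ (Aff.A φ ·ℤ x) (Aff.b φ)

actℚ : ∀ {d} → Aff d → QPt d → QPt d
actℚ φ x = zipWith ℚ._+_ (Aff.A φ ·ℚ x) (emb (Aff.b φ))

affComb : ∀ {d} → QPt d → (qs : List (QPt d)) → Vec ℚ (length qs) → QPt d
affComb q₀ []       []       = q₀
affComb q₀ (q ∷ qs) (c ∷ cs) =
  zipWith ℚ._+_ (V.map (c ℚ.*_) (zipWith ℚ._-_ q q₀)) (affComb q₀ qs cs)

coordLen : ∀ {d} → List (QPt d) → ℕ
coordLen []       = zero
coordLen (_ ∷ qs) = length qs

Coords : ∀ {d} (Q : List (QPt d)) → QPt d → Vec ℚ (coordLen Q) → Set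
Coords []        p c = ⊥
Coords (q₀ ∷ qs) p c = p ≡ affComb q₀ qs c

-- p lies in the affine span of Q (empty tuple spans ∅)
InSpan : ∀ {d} → List (QPt d) → QPt d → Set
InSpan Q p = ∃ λ c → Coords Q p c

AffIndep : ∀ {d} → List (QPt d) → Set
AffIndep []        = ⊤
AffIndep (q₀ ∷ qs) = ∀ c → affComb q₀ qs c ≡ q₀ → c ≡ replicate _ ℚ.0ℚ

Frame : ∀ {d} → List (QPt d) → Set
Frame Q = AffIndep Q

InY : ∀ {d} → List (ZPt d) → List (QPt d) → Set
InY Λ Q = Frame Q × (∀ z → z ∈ Λ → InSpan Q (emb z))

-- dim Span(Λ) + 1 = n  (n = 0 iff Λ = ∅)

DimPlusOne : ∀ {d} → List (ZPt d) → ℕ → Set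
DimPlusOne Λ n =
  (∃ λ T → length T ≡ n × All (_∈ Λ) T × AffIndep (map emb T))
  × (∀ T → All (_∈ Λ) T → AffIndep (map emb T) → length T ℕ.≤ n)

LexLe : ∀ {m} → Vec ℚ m → Vec ℚ m → Set
LexLe []       []       = ⊤
LexLe (x ∷ xs) (y ∷ ys) = (x ℚ.< y) ⊎ ((x ≡ y) × LexLe xs ys)

-- Hermite normal form (row-style, canonical under left multiplication
-- by GL(d,ℤ)): rows 0..r-1 nonzero with strictly increasing pivot
-- columns, positive pivots, zero left of each pivot, entries above a
-- pivot reduced into [0, pivot); rows r..d-1 zero.

IsHNF : ∀ {d k} → Mat d k → Set
IsHNF {d} {k} H =
  Σ ℕ λ r → Σ (r ℕ.≤ d) λ r≤d → Σ (Fin r → Fin k) λ piv →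
    let row = λ (i : Fin r) → inject≤ i r≤d in
      (∀ i i' → i <F i' → toℕ (piv i) ℕ.< toℕ (piv i'))
    × (∀ i → ℤ.0ℤ ℤ.< H (row i) (piv i))
    × (∀ i j → toℕ j ℕ.< toℕ (piv i) → H (row i) j ≡ ℤ.0ℤ)
    × (∀ i j → r ℕ.≤ toℕ i → H i j ≡ ℤ.0ℤ)
    × (∀ i i' → i <F i' →
         (ℤ.0ℤ ℤ.≤ H (row i) (piv i')) × (H (row i) (piv i') ℤ.< H (row i') (piv i')))

-- The procedure CFWF, as a relation  CFWF Λ Q Λ' T'
-- ("(Λ', T') is a possible output of CFWF(Λ, Q)", ranging over all
-- admissible choices of A in step 3).

InSpanℤ : ∀ {d} → List (ZPt d) → ZPt d → Set
InSpanℤ T p = InSpan (map emb T) (emb p)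

-- Step 1: points of Q lying in Λ, in the order of Q
data InitT {d} (Λ : List (ZPt d)) : List (QPt d) → List (ZPt d) → Set where
  init-[]   : InitT Λ [] []
  init-keep : ∀ {Q T} z → z ∈ Λ → InitT Λ Q T → InitT Λ (emb z ∷ Q) (z ∷ T)
  init-skip : ∀ {Q T} q → ¬ (∃ λ z → z ∈ Λ × emb z ≡ q) → InitT Λ Q T → InitT Λ (q ∷ Q) T

IsNext : ∀ {d} → List (ZPt d) → List (QPt d) → List (ZPt d) → ZPt d → Set
IsNext Λ Q T p =
  p ∈ Λ × ¬ InSpanℤ T p ×
  (∀ p' → p' ∈ Λ → ¬ InSpanℤ T p' →
     ∀ c c' → Coords Q (emb p) c → Coords Q (emb p') c' → LexLe c c')

-- Step 2: extend T until it has n = k+1 points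
data Extend {d} (Λ : List (ZPt d)) (Q : List (QPt d)) (n : ℕ)
     : List (ZPt d) → List (ZPt d) → Set where
  ext-done : ∀ {T} → length T ≡ n → Extend Λ Q n T T
  ext-step : ∀ {T T'} p → length T ℕ.< n → IsNext Λ Q T p →
             Extend Λ Q n (T L.++ (p ∷ [])) T' → Extend Λ Q n T T'

-- Step 3: the matrix M with columns p₁ - p₀, …, p_k - p₀
colMat : ∀ {d} → ZPt d → (ps : List (ZPt d)) → Mat d (length ps)
colMat p₀ ps r c = lookup (L.lookup ps c) r ℤ.- lookup p₀ r

data CFWF {d} (Λ : List (ZPt d)) (Q : List (QPt d))
     : List (ZPt d) → List (ZPt d) → Set where
  cfwf-empty : ∀ {T₀} → DimPlusOne Λ zero → InitT Λ Q T₀ → Extend Λ Q zero T₀ [] →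
               CFWF Λ Q [] []
  cfwf : ∀ {n T₀} p₀ ps (A : Mat d d) →
         DimPlusOne Λ n → InitT Λ Q T₀ → Extend Λ Q n T₀ (p₀ ∷ ps) →
         InGL d A → IsHNF (A ·M colMat p₀ ps) →
         let ψ = λ x → A ·ℤ zipWith ℤ._-_ x p₀ in
         CFWF Λ Q (map ψ Λ) (map ψ (p₀ ∷ ps))

-- equality of finite sets represented by lists
SameSet : ∀ {A : Set} → List A → List A → Set
SameSet xs ys = ∀ x → (x ∈ xs → x ∈ ys) × (x ∈ ys → x ∈ xs)

module Submission where

-- Let φ ∈ Aff(d, ℤ) with linear part A_φ.  On ℚ^d, φ acts by an
-- injective affine map, so it carries frames to frames, spans to spans
-- and coordinates with respect to Q to the same coordinates with
-- respect to φQ.  Hence (φΛ, φQ) ∈ Y_d, and steps 1 and 2 of the run on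
-- (φΛ, φQ) select exactly φT, where T = (p₀, …, p_k) is selected on
-- (Λ, Q).  The difference matrix of φT is A_φ M, so in step 3 both
-- A₁ M and A₂ A_φ M are Hermite normal forms of M; by uniqueness of the
-- HNF they are equal, hence ψ₁ = ψ₂ ∘ φ on Span(T) ⊇ Λ.

open import Defs
open import Data.Nat using (ℕ; NonZero)
open import Data.List using (List; map)
open import Data.Product using (_×_)
open import Relation.Binary.PropositionalEquality using (_≡_)

open import Level using (0ℓ)
open import Function using (id; _∘_)
open import Data.Empty using (⊥; ⊥-elim)
open import Data.Product using (Σ; _,_; proj₁; proj₂)
open import Data.Sum using (_⊎_; inj₁; inj₂)
open import Relation.Nullary using (¬_; yes; no)
open import Relation.Binary.Definitions using (tri<; tri≈; tri>)
open import Relation.Binary.PropositionalEquality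
  using (refl; sym; trans; cong; cong₂; subst; subst₂; module ≡-Reasoning)
open import Algebra.Bundles using (CommutativeRing)
open import Algebra.Structures using (IsCommutativeRing)
open import Data.Nat using (zero; suc)
import Data.Nat as ℕ
import Data.Nat.Properties as ℕP
open import Data.Fin using (Fin; zero; suc; toℕ; fromℕ<; punchIn; punchOut)
import Data.Fin.Properties as FinP
open import Data.Integer as ℤ using (ℤ)
import Data.Integer.Properties as ℤP
open import Data.Rational as ℚ using (ℚ)
import Data.Rational.Properties as ℚP
open import Data.Vec as V using (Vec; []; _∷_; lookup; zipWith; replicate)
import Data.Vec.Properties as VP
open import Data.List as L using ([]; _∷_; length; _++_)
import Data.List.Properties as LP
open import Data.List.Membership.Propositional using (_∈_)
open import Data.List.Membership.Propositional.Properties using (∈-map⁺; ∈-map⁻)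
open import Data.List.Relation.Unary.All as All using (All; []; _∷_)
import Data.List.Relation.Unary.All.Properties as AllP
open import Data.List.Relation.Binary.Sublist.Propositional using (_⊆_; []; _∷_; _∷ʳ_)

-- Both 'sumFin' (over ℤ) and 'sumFinℚ' (over ℚ) are
-- instances; the laws are those of the library's 'sum', transported
-- along the evident equation  Σ n f ≡ sum f.
module FinSums {R : Set} {_+_ _*_ : R → R → R} {neg : R → R} {0# 1# : R}
  (isCR : IsCommutativeRing _≡_ _+_ _*_ neg 0# 1#)
  (Σ : ∀ n → (Fin n → R) → R)
  (Σ-zero : ∀ f → Σ zero f ≡ 0#)
  (Σ-suc : ∀ n f → Σ (suc n) f ≡ f zero + Σ n (f ∘ suc)) where

  ring : CommutativeRing 0ℓ 0ℓ
  ring = record { isCommutativeRing = isCR }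

  open CommutativeRing ring using (+-identityʳ; *-comm; *-assoc)
  open import Algebra.Properties.Semiring.Sum (CommutativeRing.semiring ring)
  open import Algebra.Properties.Ring (CommutativeRing.ring ring) using (-1*x≈-x)
  open ≡-Reasoning

  Σ≡sum : ∀ n f → Σ n f ≡ sum f
  Σ≡sum zero    f = Σ-zero f
  Σ≡sum (suc n) f = trans (Σ-suc n f) (cong (f zero +_) (Σ≡sum n (f ∘ suc)))

  Σ-cong : ∀ n {f g : Fin n → R} → (∀ i → f i ≡ g i) → Σ n f ≡ Σ n g
  Σ-cong n {f} {g} f≗g = begin
    Σ n f   ≡⟨ Σ≡sum n f ⟩
    sum f   ≡⟨ sum-cong-≗ f≗g ⟩
    sum g   ≡⟨ Σ≡sum n g ⟨
    Σ n g   ∎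

  Σ-+ : ∀ n f g → Σ n (λ i → f i + g i) ≡ Σ n f + Σ n g
  Σ-+ n f g = begin
    Σ n (λ i → f i + g i)  ≡⟨ Σ≡sum n _ ⟩
    sum (λ i → f i + g i)  ≡⟨ ∑-distrib-+ f g ⟩
    sum f + sum g          ≡⟨ cong₂ _+_ (Σ≡sum n f) (Σ≡sum n g) ⟨
    Σ n f + Σ n g          ∎

  Σ-zeros : ∀ n f → (∀ i → f i ≡ 0#) → Σ n f ≡ 0#
  Σ-zeros n f f≗0 = begin
    Σ n f               ≡⟨ Σ≡sum n f ⟩
    sum f               ≡⟨ sum-cong-≗ f≗0 ⟩
    sum {n} (λ _ → 0#)  ≡⟨ sum-replicate-zero n ⟩
    0#                  ∎

  Σ-*ˡ : ∀ n c f → c * Σ n f ≡ Σ n (λ i → c * f i)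
  Σ-*ˡ n c f = begin
    c * Σ n f           ≡⟨ cong (c *_) (Σ≡sum n f) ⟩
    c * sum f           ≡⟨ *-distribˡ-sum c f ⟩
    sum (λ i → c * f i) ≡⟨ Σ≡sum n _ ⟨
    Σ n (λ i → c * f i) ∎

  Σ-*ʳ : ∀ n c f → Σ n f * c ≡ Σ n (λ i → f i * c)
  Σ-*ʳ n c f = trans (*-comm _ c) (trans (Σ-*ˡ n c f) (Σ-cong n (λ i → *-comm c (f i))))

  Σ-neg : ∀ n f → Σ n (λ i → neg (f i)) ≡ neg (Σ n f)
  Σ-neg n f = begin
    Σ n (λ i → neg (f i))       ≡⟨ Σ-cong n (λ i → -1*x≈-x (f i)) ⟨
    Σ n (λ i → neg 1# * f i)    ≡⟨ Σ-*ˡ n (neg 1#) f ⟨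
    neg 1# * Σ n f              ≡⟨ -1*x≈-x _ ⟩
    neg (Σ n f)                 ∎

  Σ-swap : ∀ m n (f : Fin m → Fin n → R) →
           Σ m (λ i → Σ n (f i)) ≡ Σ n (λ j → Σ m (λ i → f i j))
  Σ-swap m n f = begin
    Σ m (λ i → Σ n (f i))             ≡⟨ Σ-cong m (λ i → Σ≡sum n (f i)) ⟩
    Σ m (λ i → sum (f i))             ≡⟨ Σ≡sum m _ ⟩
    sum (λ i → sum (f i))             ≡⟨ ∑-comm f ⟩
    sum (λ j → sum (λ i → f i j))     ≡⟨ Σ≡sum n _ ⟨
    Σ n (λ j → sum (λ i → f i j))     ≡⟨ Σ-cong n (λ j → Σ≡sum m _) ⟨
    Σ n (λ j → Σ m (λ i → f i j))     ∎

  Σ-Σ-assoc : ∀ m n (a : Fin m → R) (b : Fin m → Fin n → R) (c : Fin n → R) →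
              Σ n (λ l → Σ m (λ k → a k * b k l) * c l) ≡ Σ m (λ k → a k * Σ n (λ l → b k l * c l))
  Σ-Σ-assoc m n a b c = begin
    Σ n (λ l → Σ m (λ k → a k * b k l) * c l)     ≡⟨ Σ-cong n (λ l → Σ-*ʳ m (c l) _) ⟩
    Σ n (λ l → Σ m (λ k → (a k * b k l) * c l))   ≡⟨ Σ-swap n m _ ⟩
    Σ m (λ k → Σ n (λ l → (a k * b k l) * c l))   ≡⟨ Σ-cong m (λ k → Σ-cong n (λ l → *-assoc (a k) (b k l) (c l))) ⟩
    Σ m (λ k → Σ n (λ l → a k * (b k l * c l)))   ≡⟨ Σ-cong m (λ k → Σ-*ˡ n (a k) _) ⟨
    Σ m (λ k → a k * Σ n (λ l → b k l * c l))     ∎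

  Σ-single : ∀ n f (i : Fin n) → (∀ j → ¬ j ≡ i → f j ≡ 0#) → Σ n f ≡ f i
  Σ-single (suc n) f i others = begin
    Σ (suc n) f                   ≡⟨ Σ≡sum (suc n) f ⟩
    sum f                         ≡⟨ sum-remove f ⟩
    f i + sum (f ∘ punchIn i)     ≡⟨ cong (f i +_) (sum-cong-≗ (λ j → others _ (FinP.punchInᵢ≢i i j))) ⟩
    f i + sum {n} (λ _ → 0#)      ≡⟨ cong (f i +_) (sum-replicate-zero n) ⟩
    f i + 0#                      ≡⟨ +-identityʳ _ ⟩
    f i                           ∎

module ΣZ = FinSums ℤP.+-*-isCommutativeRing sumFin (λ _ → refl) (λ _ _ → refl)
module ΣQ = FinSums ℚP.+-*-isCommutativeRing sumFinℚ (λ _ → refl) (λ _ _ → refl)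

-- Needed later are the identity matrix 'idM' and
-- 'inverse-left': an integer matrix of determinant ±1 has the integer
-- left inverse det A · adj A.  It rests on the two characteristic properties of the
-- Laplace expansion 'det': it is linear in every column, and it
-- vanishes when two columns coincide (proved via the sign change under
-- a swap of adjacent columns).
module Determinant where
  open import Data.Integer using (_+_; _*_; -_; +_; -[1+_]; 0ℤ; 1ℤ)
  open import Data.Integer.Solver using (module +-*-Solver)
  open +-*-Solver using (solve; _:+_; _:*_; _:=_)

  minor : ∀ {n} → Fin (suc n) → Mat (suc n) (suc n) → Mat n n
  minor j M r c = M (suc r) (punchIn j c)

  term : ∀ {n} → Mat (suc n) (suc n) → Fin (suc n) → ℤ
  term {n} M j = sgn j * (M zero j * det n (minor j M))

  det-cong : ∀ n {M N : Mat n n} → (∀ r c → M r c ≡ N r c) → det n M ≡ det n N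
  det-cong zero    M≗N = refl
  det-cong (suc n) M≗N = ΣZ.Σ-cong (suc n) λ j →
    cong₂ (λ a b → sgn j * (a * b)) (M≗N zero j) (det-cong n (λ r c → M≗N (suc r) (punchIn j c)))

  AgreeOff : ∀ {n} → Fin n → Mat n n → Mat n n → Set
  AgreeOff l M N = ∀ r c → ¬ c ≡ l → M r c ≡ N r c

  minor-col : ∀ {n} {j l : Fin (suc n)} (M : Mat (suc n) (suc n)) (j≢l : ¬ j ≡ l) r →
              minor j M r (punchOut j≢l) ≡ M (suc r) l
  minor-col M j≢l r = cong (M (suc r)) (FinP.punchIn-punchOut j≢l)

  punchIn≢ : ∀ {n} {j l : Fin (suc n)} (j≢l : ¬ j ≡ l) c → ¬ c ≡ punchOut j≢l → ¬ punchIn j c ≡ l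
  punchIn≢ {j = j} j≢l c c≢ e =
    c≢ (FinP.punchIn-injective j c (punchOut j≢l) (trans e (sym (FinP.punchIn-punchOut j≢l))))

  agreeOff-minor : ∀ {n} {j l : Fin (suc n)} {M N} (j≢l : ¬ j ≡ l) → AgreeOff l M N →
                   AgreeOff (punchOut j≢l) (minor j M) (minor j N)
  agreeOff-minor {j = j} j≢l M≈N r c c≢ = M≈N (suc r) (punchIn j c) (punchIn≢ j≢l c c≢)

  -- deleting column l itself removes the only place where M and N differ
  agreeOff-minor-same : ∀ {n} {l : Fin (suc n)} {M N} → AgreeOff l M N → ∀ r c → minor l M r c ≡ minor l N r c
  agreeOff-minor-same {l = l} M≈N r c = M≈N (suc r) (punchIn l c) (FinP.punchInᵢ≢i l c)

  det-additive : ∀ n (l : Fin n) (M N P : Mat n n) → AgreeOff l N M → AgreeOff l P M →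
                 (∀ r → M r l ≡ N r l + P r l) → det n M ≡ det n N + det n P
  det-additive (suc n) l M N P N≈M P≈M Ml =
    trans (ΣZ.Σ-cong (suc n) split) (ΣZ.Σ-+ (suc n) (term N) (term P))
    where
    split : ∀ j → term M j ≡ term N j + term P j
    split j with j FinP.≟ l
    ... | yes refl = begin
      sgn j * (M zero j * det n (minor j M))
        ≡⟨ cong (λ a → sgn j * (a * det n (minor j M))) (Ml zero) ⟩
      sgn j * ((N zero j + P zero j) * det n (minor j M))
        ≡⟨ solve 4 (λ s a b D → s :* ((a :+ b) :* D) := s :* (a :* D) :+ s :* (b :* D)) refl
                   (sgn j) (N zero j) (P zero j) (det n (minor j M)) ⟩
      sgn j * (N zero j * det n (minor j M)) + sgn j * (P zero j * det n (minor j M))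
        ≡⟨ cong₂ (λ D D' → sgn j * (N zero j * D) + sgn j * (P zero j * D'))
                 (det-cong n (λ r c → sym (agreeOff-minor-same N≈M r c)))
                 (det-cong n (λ r c → sym (agreeOff-minor-same P≈M r c))) ⟩
      term N j + term P j ∎
      where open ≡-Reasoning
    ... | no j≢l = begin
      sgn j * (M zero j * det n (minor j M))
        ≡⟨ cong (λ D → sgn j * (M zero j * D)) minors-split ⟩
      sgn j * (M zero j * (det n (minor j N) + det n (minor j P)))
        ≡⟨ solve 4 (λ s a x y → s :* (a :* (x :+ y)) := s :* (a :* x) :+ s :* (a :* y)) refl
                   (sgn j) (M zero j) (det n (minor j N)) (det n (minor j P)) ⟩
      sgn j * (M zero j * det n (minor j N)) + sgn j * (M zero j * det n (minor j P))
        ≡⟨ cong₂ (λ a b → sgn j * (a * det n (minor j N)) + sgn j * (b * det n (minor j P)))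
                 (sym (N≈M zero j j≢l)) (sym (P≈M zero j j≢l)) ⟩
      term N j + term P j ∎
      where
      open ≡-Reasoning
      minors-split : det n (minor j M) ≡ det n (minor j N) + det n (minor j P)
      minors-split = det-additive n (punchOut j≢l) (minor j M) (minor j N) (minor j P)
        (agreeOff-minor j≢l N≈M) (agreeOff-minor j≢l P≈M)
        (λ r → trans (minor-col M j≢l r)
                 (trans (Ml (suc r)) (sym (cong₂ _+_ (minor-col N j≢l r) (minor-col P j≢l r)))))

  det-homogeneous : ∀ n (l : Fin n) (M N : Mat n n) s → AgreeOff l M N →
                    (∀ r → M r l ≡ s * N r l) → det n M ≡ s * det n N
  det-homogeneous (suc n) l M N s M≈N Ml =
    trans (ΣZ.Σ-cong (suc n) scale) (sym (ΣZ.Σ-*ˡ (suc n) s (term N)))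
    where
    scale : ∀ j → term M j ≡ s * term N j
    scale j with j FinP.≟ l
    ... | yes refl =
      trans (cong₂ (λ a D → sgn j * (a * D)) (Ml zero) (det-cong n (agreeOff-minor-same M≈N)))
            (solve 4 (λ s' x a D → s' :* ((x :* a) :* D) := x :* (s' :* (a :* D))) refl
                   (sgn j) s (N zero j) (det n (minor j N)))
    ... | no j≢l =
      let minor-scales = det-homogeneous n (punchOut j≢l) (minor j M) (minor j N) s
            (agreeOff-minor j≢l M≈N)
            (λ r → trans (minor-col M j≢l r) (trans (Ml (suc r)) (cong (s *_) (sym (minor-col N j≢l r)))))
      in trans (cong₂ (λ a D → sgn j * (a * D)) (M≈N zero j j≢l) minor-scales)
               (solve 4 (λ s' x a D → s' :* (a :* (x :* D)) := x :* (s' :* (a :* D))) refl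
                      (sgn j) s (N zero j) (det n (minor j N)))

  Adjacent : ∀ {n} → Fin n → Fin n → Set
  Adjacent c c' = toℕ c' ≡ suc (toℕ c)

  ColSwap : ∀ {n} → Mat n n → Mat n n → Fin n → Fin n → Set
  ColSwap M M' c c' =
    (∀ r k → ¬ k ≡ c → ¬ k ≡ c' → M' r k ≡ M r k) × (∀ r → M' r c ≡ M r c') × (∀ r → M' r c' ≡ M r c)

  colSwap-sym : ∀ {n} {M M' : Mat n n} {c c'} → ColSwap M M' c c' → ColSwap M' M c c'
  colSwap-sym (off , at-c , at-c') = (λ r k k≢c k≢c' → sym (off r k k≢c k≢c')) , (λ r → sym (at-c' r)) , (λ r → sym (at-c r))

  sgn-toℕ : ∀ {m n} (a : Fin m) (b : Fin n) → toℕ a ≡ toℕ b → sgn a ≡ sgn b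
  sgn-toℕ zero          zero          _ = refl
  sgn-toℕ (suc zero)    (suc zero)    _ = refl
  sgn-toℕ (suc (suc a)) (suc (suc b)) e = sgn-toℕ a b (ℕP.suc-injective (ℕP.suc-injective e))
  sgn-toℕ zero          (suc b)       ()
  sgn-toℕ (suc a)       zero          ()
  sgn-toℕ (suc zero)    (suc (suc b)) ()
  sgn-toℕ (suc (suc a)) (suc zero)    ()

  sgn-suc : ∀ {n} (a : Fin n) → sgn (suc a) ≡ - sgn a
  sgn-suc zero    = refl
  sgn-suc (suc a) = trans (sym (ℤP.neg-involutive (sgn a))) (cong -_ (sym (sgn-suc a)))

  sgn-adjacent : ∀ {n} {c c' : Fin n} → Adjacent c c' → sgn c' ≡ - sgn c
  sgn-adjacent {c = c} {c'} adj = trans (sgn-toℕ c' (suc c) adj) (sgn-suc c)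

  punchIn-adjacent : ∀ {n} {c c' : Fin (suc n)} → Adjacent c c' → ∀ k →
                     (punchIn c k ≡ punchIn c' k) ⊎ (punchIn c k ≡ c' × punchIn c' k ≡ c)
  punchIn-adjacent {c = zero}  {suc zero}    _   zero    = inj₂ (refl , refl)
  punchIn-adjacent {c = zero}  {suc zero}    _   (suc k) = inj₁ refl
  punchIn-adjacent {c = suc c} {suc c'}      adj zero    = inj₁ refl
  punchIn-adjacent {c = suc c} {suc c'}      adj (suc k) with punchIn-adjacent {c = c} {c'} (ℕP.suc-injective adj) k
  ... | inj₁ same           = inj₁ (cong suc same)
  ... | inj₂ (at-c' , at-c) = inj₂ (cong suc at-c' , cong suc at-c)
  punchIn-adjacent {c = zero}  {suc (suc _)} () _

  minor-colSwap-adjacent : ∀ {n} {M M' : Mat (suc n) (suc n)} {c c'} → Adjacent c c' → ColSwap M M' c c' →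
                           ∀ r k → minor c M' r k ≡ minor c' M r k
  minor-colSwap-adjacent {M = M} {M'} {c} {c'} adj (off , at-c , at-c') r k with punchIn-adjacent adj k
  ... | inj₁ same = trans (off (suc r) (punchIn c k) (FinP.punchInᵢ≢i c k)
                            (λ e → FinP.punchInᵢ≢i c' k (trans (sym same) e)))
                          (cong (M (suc r)) same)
  ... | inj₂ (to-c' , to-c) = trans (cong (M' (suc r)) to-c') (trans (at-c' (suc r)) (cong (M (suc r)) (sym to-c)))

  -- punchIn j is strictly monotone, so it reflects adjacency
  adjacent-punchIn⁻ : ∀ {n} (j : Fin (suc n)) (a b : Fin n) →
                      Adjacent (punchIn j a) (punchIn j b) → Adjacent a b
  adjacent-punchIn⁻ zero    a       b             e = ℕP.suc-injective e
  adjacent-punchIn⁻ (suc j) zero    zero          ()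
  adjacent-punchIn⁻ (suc j) zero    (suc zero)    e = refl
  adjacent-punchIn⁻ (suc zero) zero (suc (suc b)) ()
  adjacent-punchIn⁻ (suc (suc j)) zero (suc (suc b)) ()
  adjacent-punchIn⁻ (suc j) (suc a) zero          ()
  adjacent-punchIn⁻ (suc j) (suc a) (suc b)       e = cong suc (adjacent-punchIn⁻ j a b (ℕP.suc-injective e))

  adjacent-punchOut : ∀ {n} {j c c' : Fin (suc n)} (j≢c : ¬ j ≡ c) (j≢c' : ¬ j ≡ c') →
                      Adjacent c c' → Adjacent (punchOut j≢c) (punchOut j≢c')
  adjacent-punchOut {j = j} j≢c j≢c' adj = adjacent-punchIn⁻ j (punchOut j≢c) (punchOut j≢c')
    (subst₂ Adjacent (sym (FinP.punchIn-punchOut j≢c)) (sym (FinP.punchIn-punchOut j≢c')) adj)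

  minor-colSwap : ∀ {n} {M M' : Mat (suc n) (suc n)} {j c c'} (j≢c : ¬ j ≡ c) (j≢c' : ¬ j ≡ c') →
                  ColSwap M M' c c' → ColSwap (minor j M) (minor j M') (punchOut j≢c) (punchOut j≢c')
  minor-colSwap {M = M} {M'} {j} j≢c j≢c' (off , at-c , at-c') =
    (λ r k k≢a k≢b → off (suc r) (punchIn j k) (punchIn≢ j≢c k k≢a) (punchIn≢ j≢c' k k≢b)) ,
    (λ r → trans (minor-col M' j≢c r) (trans (at-c (suc r)) (sym (minor-col M j≢c' r)))) ,
    (λ r → trans (minor-col M' j≢c' r) (trans (at-c' (suc r)) (sym (minor-col M j≢c r))))

  Σ-exchange-adjacent : ∀ n (t u : Fin n → ℤ) (c c' : Fin n) → Adjacent c c' →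
    (∀ j → ¬ j ≡ c → ¬ j ≡ c' → t j ≡ u j) → t c ≡ u c' → t c' ≡ u c → sumFin n t ≡ sumFin n u
  Σ-exchange-adjacent (suc (suc m)) t u zero (suc zero) _ others tc tc' = begin
    t zero + (t (suc zero) + rest t)  ≡⟨ cong₂ (λ a b → a + (b + rest t)) tc tc' ⟩
    u (suc zero) + (u zero + rest t)  ≡⟨ solve 3 (λ a b r → a :+ (b :+ r) := b :+ (a :+ r)) refl (u (suc zero)) (u zero) (rest t) ⟩
    u zero + (u (suc zero) + rest t)  ≡⟨ cong (λ r → u zero + (u (suc zero) + r)) (ΣZ.Σ-cong m (λ i → others (suc (suc i)) (λ ()) (λ ()))) ⟩
    u zero + (u (suc zero) + rest u)  ∎
    where
    open ≡-Reasoning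
    rest : (Fin (suc (suc m)) → ℤ) → ℤ
    rest f = sumFin m (λ i → f (suc (suc i)))
  Σ-exchange-adjacent (suc (suc m)) t u zero (suc (suc c')) () _ _ _
  Σ-exchange-adjacent (suc n) t u (suc c) (suc c') adj others tc tc' =
    cong₂ _+_ (others zero (λ ()) (λ ()))
      (Σ-exchange-adjacent n (t ∘ suc) (u ∘ suc) c c' (ℕP.suc-injective adj)
        (λ j j≢c j≢c' → others (suc j) (j≢c ∘ FinP.suc-injective) (j≢c' ∘ FinP.suc-injective)) tc tc')

  det-swap : ∀ n {M M' : Mat n n} {c c'} → Adjacent c c' → ColSwap M M' c c' → det n M' ≡ - det n M
  det-swap (suc n) {M} {M'} {c} {c'} adj sw@(off , at-c , at-c') =
    trans (Σ-exchange-adjacent (suc n) (term M') (λ j → - term M j) c c' adj outside swapped-c swapped-c')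
          (ΣZ.Σ-neg (suc n) (term M))
    where
    open ≡-Reasoning
    swapped-c : term M' c ≡ - term M c'
    swapped-c = begin
      sgn c * (M' zero c * det n (minor c M'))
        ≡⟨ cong₂ (λ a D → sgn c * (a * D)) (at-c zero) (det-cong n (minor-colSwap-adjacent adj sw)) ⟩
      sgn c * (M zero c' * det n (minor c' M))
        ≡⟨ cong (_* (M zero c' * det n (minor c' M))) (trans (sym (ℤP.neg-involutive _)) (cong -_ (sym (sgn-adjacent adj)))) ⟩
      - sgn c' * (M zero c' * det n (minor c' M))
        ≡⟨ ℤP.neg-distribˡ-* (sgn c') _ ⟨
      - term M c' ∎
    swapped-c' : term M' c' ≡ - term M c
    swapped-c' = begin
      sgn c' * (M' zero c' * det n (minor c' M'))
        ≡⟨ cong₂ (λ a D → sgn c' * (a * D)) (at-c' zero)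
                 (det-cong n (λ r k → sym (minor-colSwap-adjacent adj (colSwap-sym sw) r k))) ⟩
      sgn c' * (M zero c * det n (minor c M))
        ≡⟨ cong (_* (M zero c * det n (minor c M))) (sgn-adjacent adj) ⟩
      - sgn c * (M zero c * det n (minor c M))
        ≡⟨ ℤP.neg-distribˡ-* (sgn c) _ ⟨
      - term M c ∎
    outside : ∀ j → ¬ j ≡ c → ¬ j ≡ c' → term M' j ≡ - term M j
    outside j j≢c j≢c' = begin
      sgn j * (M' zero j * det n (minor j M'))
        ≡⟨ cong₂ (λ a D → sgn j * (a * D)) (off zero j j≢c j≢c')
                 (det-swap n (adjacent-punchOut j≢c j≢c' adj) (minor-colSwap j≢c j≢c' sw)) ⟩
      sgn j * (M zero j * - det n (minor j M))
        ≡⟨ cong (sgn j *_) (ℤP.neg-distribʳ-* (M zero j) _) ⟨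
      sgn j * - (M zero j * det n (minor j M))
        ≡⟨ ℤP.neg-distribʳ-* (sgn j) _ ⟨
      - term M j ∎

  swapCol : ∀ {n} → Mat n n → Fin n → Fin n → Mat n n
  swapCol M x y r k with k FinP.≟ x | k FinP.≟ y
  ... | yes _ | _     = M r y
  ... | no _  | yes _ = M r x
  ... | no _  | no _  = M r k

  swapCol-colSwap : ∀ {n} (M : Mat n n) {x y} → ¬ y ≡ x → ColSwap M (swapCol M x y) x y
  swapCol-colSwap M {x} {y} y≢x = off , at-x , at-y
    where
    off : ∀ r k → ¬ k ≡ x → ¬ k ≡ y → swapCol M x y r k ≡ M r k
    off r k k≢x k≢y with k FinP.≟ x | k FinP.≟ y
    ... | yes k≡x | _       = ⊥-elim (k≢x k≡x)
    ... | no _    | yes k≡y = ⊥-elim (k≢y k≡y)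
    ... | no _    | no _    = refl
    at-x : ∀ r → swapCol M x y r x ≡ M r y
    at-x r with x FinP.≟ x
    ... | yes _   = refl
    ... | no x≢x  = ⊥-elim (x≢x refl)
    at-y : ∀ r → swapCol M x y r y ≡ M r x
    at-y r with y FinP.≟ x | y FinP.≟ y
    ... | yes y≡x | _      = ⊥-elim (y≢x y≡x)
    ... | no _    | yes _  = refl
    ... | no _    | no y≢y = ⊥-elim (y≢y refl)

  self-negative⇒0 : ∀ x → x ≡ - x → x ≡ 0ℤ
  self-negative⇒0 (+ zero)  _ = refl
  self-negative⇒0 (+ suc n) ()
  self-negative⇒0 -[1+ n ]  ()

  -- two equal columns a < b, by induction on their distance: the
  -- adjacent case is det M ≡ - det M; otherwise move b one step left
  det-equal-cols-at : ∀ n (M : Mat n n) (a b : Fin n) g → suc (toℕ a ℕ.+ g) ≡ toℕ b →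
                      (∀ r → M r a ≡ M r b) → det n M ≡ 0ℤ
  det-equal-cols-at n M a b zero dist same = self-negative⇒0 _
    (det-swap n (trans (sym dist) (cong suc (ℕP.+-identityʳ _)))
                ((λ _ _ _ _ → refl) , same , (λ r → sym (same r))))
  det-equal-cols-at n M a b (suc g) dist same = begin
    det n M             ≡⟨ ℤP.neg-involutive _ ⟨
    - - det n M         ≡⟨ cong -_ (det-swap n b₀-adjacent-b (swapCol-colSwap M b≢b₀)) ⟨
    - det n M'          ≡⟨ cong -_ (det-equal-cols-at n M' a b₀ g (sym toℕ-b₀) same') ⟩
    - 0ℤ                ∎
    where
    open ≡-Reasoning
    toℕ-b≡ : toℕ b ≡ suc (suc (toℕ a ℕ.+ g))
    toℕ-b≡ = trans (sym dist) (cong suc (ℕP.+-suc (toℕ a) g))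
    b₀<n : suc (toℕ a ℕ.+ g) ℕ.< n
    b₀<n = ℕP.≤-trans (ℕP.≤-reflexive (sym toℕ-b≡)) (ℕP.<⇒≤ (FinP.toℕ<n b))
    b₀ : Fin n
    b₀ = fromℕ< b₀<n
    toℕ-b₀ : toℕ b₀ ≡ suc (toℕ a ℕ.+ g)
    toℕ-b₀ = FinP.toℕ-fromℕ< b₀<n
    b₀-adjacent-b : Adjacent b₀ b
    b₀-adjacent-b = trans toℕ-b≡ (cong suc (sym toℕ-b₀))
    b≢b₀ : ¬ b ≡ b₀
    b≢b₀ b≡b₀ = ℕP.1+n≢n (sym (trans (cong toℕ (sym b≡b₀)) b₀-adjacent-b))
    a<b₀ : toℕ a ℕ.< toℕ b₀
    a<b₀ = ℕP.≤-trans (ℕ.s≤s (ℕP.m≤m+n (toℕ a) g)) (ℕP.≤-reflexive (sym toℕ-b₀))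
    M' : Mat n n
    M' = swapCol M b₀ b
    same' : ∀ r → M' r a ≡ M' r b₀
    same' r = trans (proj₁ (swapCol-colSwap M b≢b₀) r a (λ a≡b₀ → ℕP.<-irrefl (cong toℕ a≡b₀) a<b₀)
                                                        (λ a≡b → ℕP.<-irrefl (cong toℕ a≡b) (ℕP.<-trans a<b₀ (ℕP.≤-reflexive (sym b₀-adjacent-b)))))
                    (trans (same r) (sym (proj₁ (proj₂ (swapCol-colSwap M b≢b₀)) r)))

  det-equal-cols : ∀ n (M : Mat n n) (a b : Fin n) → ¬ a ≡ b → (∀ r → M r a ≡ M r b) → det n M ≡ 0ℤ
  det-equal-cols n M a b a≢b same with ℕP.<-cmp (toℕ a) (toℕ b)
  ... | tri< a<b _ _ = let (g , dist) = ℕP.m≤n⇒∃[o]m+o≡n a<b in det-equal-cols-at n M a b g dist same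
  ... | tri≈ _ a≡b _ = ⊥-elim (a≢b (FinP.toℕ-injective a≡b))
  ... | tri> _ _ b<a = let (g , dist) = ℕP.m≤n⇒∃[o]m+o≡n b<a in det-equal-cols-at n M b a g dist (λ r → sym (same r))

  replaceCol : ∀ {n} → Mat n n → Fin n → (Fin n → ℤ) → Mat n n
  replaceCol A l v r c with c FinP.≟ l
  ... | yes _ = v r
  ... | no _  = A r c

  replaceCol-at : ∀ {n} (A : Mat n n) l v r → replaceCol A l v r l ≡ v r
  replaceCol-at A l v r with l FinP.≟ l
  ... | yes _   = refl
  ... | no l≢l  = ⊥-elim (l≢l refl)

  replaceCol-off : ∀ {n} (A : Mat n n) l v → AgreeOff l (replaceCol A l v) A
  replaceCol-off A l v r c c≢l with c FinP.≟ l
  ... | yes c≡l = ⊥-elim (c≢l c≡l)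
  ... | no _    = refl

  replaceCol-cong : ∀ {n} (A : Mat n n) l {v w : Fin n → ℤ} → (∀ r → v r ≡ w r) →
                    ∀ r c → replaceCol A l v r c ≡ replaceCol A l w r c
  replaceCol-cong A l v≗w r c with c FinP.≟ l
  ... | yes _ = v≗w r
  ... | no _  = refl

  replaceCol-agree : ∀ {n} (A : Mat n n) l v w → AgreeOff l (replaceCol A l v) (replaceCol A l w)
  replaceCol-agree A l v w r c c≢l = trans (replaceCol-off A l v r c c≢l) (sym (replaceCol-off A l w r c c≢l))

  det-linear : ∀ n (A : Mat n n) l m (y : Fin m → ℤ) (vs : Fin m → Fin n → ℤ) →
    det n (replaceCol A l (λ r → sumFin m (λ k → y k * vs k r))) ≡ sumFin m (λ k → y k * det n (replaceCol A l (vs k)))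
  det-linear n A l zero y vs =
    det-homogeneous n l M M 0ℤ (λ _ _ _ → refl) (λ r → replaceCol-at A l _ r)
    where M = replaceCol A l (λ r → 0ℤ)
  det-linear n A l (suc m) y vs = begin
    det n (replaceCol A l (λ r → y zero * vs zero r + rest r))
      ≡⟨ det-additive n l _ _ _ (replaceCol-agree A l _ _) (replaceCol-agree A l _ _)
           (λ r → trans (replaceCol-at A l _ r) (sym (cong₂ _+_ (replaceCol-at A l _ r) (replaceCol-at A l _ r)))) ⟩
    det n (replaceCol A l (λ r → y zero * vs zero r)) + det n (replaceCol A l rest)
      ≡⟨ cong₂ _+_ (det-homogeneous n l _ _ (y zero) (replaceCol-agree A l _ _)
                     (λ r → trans (replaceCol-at A l _ r) (cong (y zero *_) (sym (replaceCol-at A l _ r)))))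
                   (det-linear n A l m (y ∘ suc) (vs ∘ suc)) ⟩
    y zero * det n (replaceCol A l (vs zero)) + sumFin m (λ k → y (suc k) * det n (replaceCol A l (vs (suc k)))) ∎
    where
    open ≡-Reasoning
    rest : Fin n → ℤ
    rest r = sumFin m (λ k → y (suc k) * vs (suc k) r)

  idM : ∀ {n} → Mat n n
  idM i j with i FinP.≟ j
  ... | yes _ = 1ℤ
  ... | no _  = 0ℤ

  idM-diag : ∀ {n} (i : Fin n) → idM i i ≡ 1ℤ
  idM-diag i with i FinP.≟ i
  ... | yes _  = refl
  ... | no i≢i = ⊥-elim (i≢i refl)

  idM-off : ∀ {n} (i j : Fin n) → ¬ i ≡ j → idM i j ≡ 0ℤ
  idM-off i j i≢j with i FinP.≟ j
  ... | yes i≡j = ⊥-elim (i≢j i≡j)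
  ... | no _    = refl

  Σ-basis : ∀ n (A : Mat n n) j r → sumFin n (λ k → A k j * idM r k) ≡ A r j
  Σ-basis n A j r =
    trans (ΣZ.Σ-single n _ r (λ k k≢r → trans (cong (A k j *_) (idM-off r k (k≢r ∘ sym))) (ℤP.*-zeroʳ (A k j))))
          (trans (cong (A r j *_) (idM-diag r)) (ℤP.*-identityʳ _))

  det-replaceCol-by-col : ∀ n (A : Mat n n) → InGL n A → ∀ l j → det n A * det n (replaceCol A l (λ r → A r j)) ≡ idM l j
  det-replaceCol-by-col n A gl l j with l FinP.≟ j
  ... | yes refl = begin
    det n A * det n (replaceCol A l (λ r → A r l))
      ≡⟨ cong (det n A *_) (det-cong n (λ r c → unchanged r c)) ⟩
    det n A * det n A   ≡⟨ unit-square gl ⟩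
    1ℤ                  ∎
    where
    open ≡-Reasoning
    unchanged : ∀ r c → replaceCol A l (λ r → A r l) r c ≡ A r c
    unchanged r c with c FinP.≟ l
    ... | yes refl = refl
    ... | no _     = refl
    unit-square : InGL n A → det n A * det n A ≡ 1ℤ
    unit-square (inj₁ det≡1)  rewrite det≡1  = refl
    unit-square (inj₂ det≡-1) rewrite det≡-1 = refl
  ... | no l≢j = trans (cong (det n A *_) (det-equal-cols n _ l j l≢j
                         (λ r → trans (replaceCol-at A l _ r) (sym (replaceCol-off A l _ r j (l≢j ∘ sym))))))
                       (ℤP.*-zeroʳ (det n A))

  -- for A ∈ GL(n, ℤ) the inverse is det A times the adjugate (det A = ±1)
  inverse : ∀ {n} → Mat n n → Mat n n
  inverse {n} A l k = det n A * det n (replaceCol A l (λ r → idM r k))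

  inverse-left : ∀ n (A : Mat n n) → InGL n A → ∀ l j → (inverse A ·M A) l j ≡ idM l j
  inverse-left n A gl l j = begin
    sumFin n (λ k → (det n A * det n (replaceCol A l (λ r → idM r k))) * A k j)
      ≡⟨ ΣZ.Σ-cong n (λ k → solve 3 (λ δ D a → (δ :* D) :* a := δ :* (a :* D)) refl
                              (det n A) (det n (replaceCol A l (λ r → idM r k))) (A k j)) ⟩
    sumFin n (λ k → det n A * (A k j * det n (replaceCol A l (λ r → idM r k))))
      ≡⟨ ΣZ.Σ-*ˡ n (det n A) _ ⟨
    det n A * sumFin n (λ k → A k j * det n (replaceCol A l (λ r → idM r k)))
      ≡⟨ cong (det n A *_) (det-linear n A l n (λ k → A k j) (λ k r → idM r k)) ⟨
    det n A * det n (replaceCol A l (λ r → sumFin n (λ k → A k j * idM r k)))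
      ≡⟨ cong (det n A *_) (det-cong n (replaceCol-cong A l (Σ-basis n A j))) ⟩
    det n A * det n (replaceCol A l (λ r → A r j))
      ≡⟨ det-replaceCol-by-col n A gl l j ⟩
    idM l j ∎
    where open ≡-Reasoning

open Determinant

-- The embedding ι : ℤ → ℚ used by 'emb' is an injective ring
-- homomorphism; each identity is checked on unnormalised rationals.
module IntegerEmbedding where
  open import Data.Integer using (+_)
  import Data.Rational.Unnormalised as U
  import Data.Rational.Unnormalised.Properties as UP
  open import Data.Integer.Solver using (module +-*-Solver)
  open +-*-Solver using (solve; con; _:+_; _:*_; _:=_)

  ι : ℤ → ℚ
  ι a = a ℚ./ 1

  toℚᵘ-ι : ∀ a → ℚ.toℚᵘ (ι a) U.≃ U.mkℚᵘ a 0
  toℚᵘ-ι a = ℚP.toℚᵘ-fromℚᵘ (U.mkℚᵘ a 0)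

  ι-+ : ∀ a b → ι (a ℤ.+ b) ≡ ι a ℚ.+ ι b
  ι-+ a b = ℚP.toℚᵘ-injective (UP.≃-trans (toℚᵘ-ι (a ℤ.+ b)) (UP.≃-sym
    (UP.≃-trans (ℚP.toℚᵘ-homo-+ (ι a) (ι b)) (UP.≃-trans (UP.+-cong (toℚᵘ-ι a) (toℚᵘ-ι b))
      (U.*≡* (solve 2 (λ a b → (a :* con (+ 1) :+ b :* con (+ 1)) :* con (+ 1) := (a :+ b) :* (con (+ 1) :* con (+ 1)))
                      refl a b))))))

  ι-* : ∀ a b → ι (a ℤ.* b) ≡ ι a ℚ.* ι b
  ι-* a b = ℚP.toℚᵘ-injective (UP.≃-trans (toℚᵘ-ι (a ℤ.* b)) (UP.≃-sym
    (UP.≃-trans (ℚP.toℚᵘ-homo-* (ι a) (ι b)) (UP.≃-trans (UP.*-cong (toℚᵘ-ι a) (toℚᵘ-ι b))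
      (U.*≡* (solve 2 (λ a b → (a :* b) :* con (+ 1) := (a :* b) :* (con (+ 1) :* con (+ 1))) refl a b))))))

  ι-neg : ∀ a → ι (ℤ.- a) ≡ ℚ.- ι a
  ι-neg a = ℚP.toℚᵘ-injective (UP.≃-trans (toℚᵘ-ι (ℤ.- a)) (UP.≃-sym
    (UP.≃-trans (ℚP.toℚᵘ-homo‿- (ι a)) (UP.-‿cong (toℚᵘ-ι a)))))

  ι-injective : ∀ a b → ι a ≡ ι b → a ≡ b
  ι-injective a b ιa≡ιb with UP.≃-trans (UP.≃-sym (toℚᵘ-ι a)) (UP.≃-trans (ℚP.toℚᵘ-cong ιa≡ιb) (toℚᵘ-ι b))
  ... | U.*≡* a*1≡b*1 = trans (sym (ℤP.*-identityʳ a)) (trans a*1≡b*1 (ℤP.*-identityʳ b))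

  ι-Σ : ∀ n f → ι (sumFin n f) ≡ sumFinℚ n (ι ∘ f)
  ι-Σ zero    f = refl
  ι-Σ (suc n) f = trans (ι-+ (f zero) (sumFin n (f ∘ suc))) (cong (ι (f zero) ℚ.+_) (ι-Σ n (f ∘ suc)))

open IntegerEmbedding

module MatrixAction where
  open import Data.Integer.Solver using (module +-*-Solver)
  open +-*-Solver using (solve; _:+_; _:*_; _:-_; :-_; _:=_)

  lookup-ext : ∀ {A : Set} {n} {xs ys : Vec A n} → (∀ i → lookup xs i ≡ lookup ys i) → xs ≡ ys
  lookup-ext {xs = xs} {ys} xs≗ys =
    trans (sym (VP.tabulate∘lookup xs)) (trans (VP.tabulate-cong xs≗ys) (VP.tabulate∘lookup ys))

  lookup-·ℤ : ∀ {d} (A : Mat d d) x i → lookup (A ·ℤ x) i ≡ sumFin d (λ j → A i j ℤ.* lookup x j)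
  lookup-·ℤ A x i = VP.lookup∘tabulate _ i

  lookup-·ℚ : ∀ {d} (A : Mat d d) x i → lookup (A ·ℚ x) i ≡ sumFinℚ d (λ j → ι (A i j) ℚ.* lookup x j)
  lookup-·ℚ A x i = VP.lookup∘tabulate _ i

  lookup-emb : ∀ {d} (x : ZPt d) i → lookup (emb x) i ≡ ι (lookup x i)
  lookup-emb x i = VP.lookup-map i _ x

  ·M-assoc : ∀ {a b c e} (A : Mat a b) (B : Mat b c) (C : Mat c e) i j →
             ((A ·M B) ·M C) i j ≡ (A ·M (B ·M C)) i j
  ·M-assoc {b = b} {c} A B C i j = ΣZ.Σ-Σ-assoc b c (A i) B (λ l → C l j)

  ·M-congˡ : ∀ {a b c} {A A' : Mat a b} (B : Mat b c) → (∀ i j → A i j ≡ A' i j) →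
             ∀ i j → (A ·M B) i j ≡ (A' ·M B) i j
  ·M-congˡ {b = b} B A≗A' i j = ΣZ.Σ-cong b (λ k → cong (ℤ._* B k j) (A≗A' i k))

  ·M-congʳ : ∀ {a b c} (A : Mat a b) {B B' : Mat b c} → (∀ i j → B i j ≡ B' i j) →
             ∀ i j → (A ·M B) i j ≡ (A ·M B') i j
  ·M-congʳ {b = b} A B≗B' i j = ΣZ.Σ-cong b (λ k → cong (A i k ℤ.*_) (B≗B' k j))

  idM-·M : ∀ {n c} (X : Mat n c) i j → (idM ·M X) i j ≡ X i j
  idM-·M {n} X i j =
    trans (ΣZ.Σ-single n _ i (λ k k≢i → cong (ℤ._* X k j) (idM-off i k (k≢i ∘ sym))))
          (trans (cong (ℤ._* X i j) (idM-diag i)) (ℤP.*-identityˡ _))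

  ·ℤ-·M : ∀ {d} (A B : Mat d d) x → (A ·M B) ·ℤ x ≡ A ·ℤ (B ·ℤ x)
  ·ℤ-·M {d} A B x = VP.tabulate-cong (λ i →
    trans (ΣZ.Σ-Σ-assoc d d (A i) B (lookup x))
          (ΣZ.Σ-cong d (λ k → cong (A i k ℤ.*_) (sym (lookup-·ℤ B x k)))))

  ·ℤ-sub : ∀ {d} (A : Mat d d) x y → A ·ℤ zipWith ℤ._-_ x y ≡ zipWith ℤ._-_ (A ·ℤ x) (A ·ℤ y)
  ·ℤ-sub {d} A x y = lookup-ext λ i → begin
    lookup (A ·ℤ zipWith ℤ._-_ x y) i
      ≡⟨ lookup-·ℤ A (zipWith ℤ._-_ x y) i ⟩
    sumFin d (λ j → A i j ℤ.* lookup (zipWith ℤ._-_ x y) j)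
      ≡⟨ ΣZ.Σ-cong d (λ j → trans (cong (A i j ℤ.*_) (VP.lookup-zipWith ℤ._-_ j x y))
                                  (solve 3 (λ a u v → a :* (u :- v) := a :* u :+ :- (a :* v)) refl
                                           (A i j) (lookup x j) (lookup y j))) ⟩
    sumFin d (λ j → A i j ℤ.* lookup x j ℤ.+ ℤ.- (A i j ℤ.* lookup y j))
      ≡⟨ ΣZ.Σ-+ d _ _ ⟩
    sumFin d (λ j → A i j ℤ.* lookup x j) ℤ.+ sumFin d (λ j → ℤ.- (A i j ℤ.* lookup y j))
      ≡⟨ cong₂ ℤ._+_ (sym (lookup-·ℤ A x i)) (trans (ΣZ.Σ-neg d _) (cong ℤ.-_ (sym (lookup-·ℤ A y i)))) ⟩
    lookup (A ·ℤ x) i ℤ.- lookup (A ·ℤ y) i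
      ≡⟨ VP.lookup-zipWith ℤ._-_ i (A ·ℤ x) (A ·ℤ y) ⟨
    lookup (zipWith ℤ._-_ (A ·ℤ x) (A ·ℤ y)) i ∎
    where open ≡-Reasoning

  -- the translation part of φ cancels in differences
  actℤ-sub : ∀ {d} (φ : Aff d) x y → zipWith ℤ._-_ (actℤ φ x) (actℤ φ y) ≡ Aff.A φ ·ℤ zipWith ℤ._-_ x y
  actℤ-sub φ x y = trans (lookup-ext λ i → begin
    lookup (zipWith ℤ._-_ (actℤ φ x) (actℤ φ y)) i
      ≡⟨ VP.lookup-zipWith ℤ._-_ i (actℤ φ x) (actℤ φ y) ⟩
    lookup (actℤ φ x) i ℤ.- lookup (actℤ φ y) i
      ≡⟨ cong₂ ℤ._-_ (VP.lookup-zipWith ℤ._+_ i (A ·ℤ x) b) (VP.lookup-zipWith ℤ._+_ i (A ·ℤ y) b) ⟩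
    (lookup (A ·ℤ x) i ℤ.+ lookup b i) ℤ.- (lookup (A ·ℤ y) i ℤ.+ lookup b i)
      ≡⟨ solve 3 (λ a c t → (a :+ t) :- (c :+ t) := a :- c) refl (lookup (A ·ℤ x) i) (lookup (A ·ℤ y) i) (lookup b i) ⟩
    lookup (A ·ℤ x) i ℤ.- lookup (A ·ℤ y) i
      ≡⟨ VP.lookup-zipWith ℤ._-_ i (A ·ℤ x) (A ·ℤ y) ⟨
    lookup (zipWith ℤ._-_ (A ·ℤ x) (A ·ℤ y)) i ∎)
    (sym (·ℤ-sub A x y))
    where
    open ≡-Reasoning
    A : Mat _ _
    A = Aff.A φ
    b : ZPt _
    b = Aff.b φ

  emb-injective : ∀ {d} (x y : ZPt d) → emb x ≡ emb y → x ≡ y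
  emb-injective x y ex≡ey = lookup-ext (λ i →
    ι-injective _ _ (trans (sym (lookup-emb x i)) (trans (cong (λ v → lookup v i) ex≡ey) (lookup-emb y i))))

  emb-·ℤ : ∀ {d} (A : Mat d d) x → emb (A ·ℤ x) ≡ A ·ℚ emb x
  emb-·ℤ {d} A x = lookup-ext λ i → begin
    lookup (emb (A ·ℤ x)) i                          ≡⟨ lookup-emb (A ·ℤ x) i ⟩
    ι (lookup (A ·ℤ x) i)                            ≡⟨ cong ι (lookup-·ℤ A x i) ⟩
    ι (sumFin d (λ j → A i j ℤ.* lookup x j))        ≡⟨ ι-Σ d _ ⟩
    sumFinℚ d (λ j → ι (A i j ℤ.* lookup x j))       ≡⟨ ΣQ.Σ-cong d (λ j → trans (ι-* (A i j) (lookup x j))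
                                                          (cong (ι (A i j) ℚ.*_) (sym (lookup-emb x j)))) ⟩
    sumFinℚ d (λ j → ι (A i j) ℚ.* lookup (emb x) j) ≡⟨ lookup-·ℚ A (emb x) i ⟨
    lookup (A ·ℚ emb x) i                            ∎
    where open ≡-Reasoning

  ·ℚ-·M : ∀ {d} (A B : Mat d d) x → (A ·M B) ·ℚ x ≡ A ·ℚ (B ·ℚ x)
  ·ℚ-·M {d} A B x = VP.tabulate-cong (λ i →
    trans (ΣQ.Σ-cong d (λ l → cong (ℚ._* lookup x l)
            (trans (ι-Σ d (λ k → A i k ℤ.* B k l)) (ΣQ.Σ-cong d (λ k → ι-* (A i k) (B k l))))))
    (trans (ΣQ.Σ-Σ-assoc d d (ι ∘ A i) (λ k l → ι (B k l)) (lookup x))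
           (ΣQ.Σ-cong d (λ k → cong (ι (A i k) ℚ.*_) (sym (lookup-·ℚ B x k))))))

  ·ℚ-cong : ∀ {d} {A B : Mat d d} x → (∀ i j → A i j ≡ B i j) → A ·ℚ x ≡ B ·ℚ x
  ·ℚ-cong {d} x A≗B = VP.tabulate-cong (λ i → ΣQ.Σ-cong d (λ j → cong (λ a → ι a ℚ.* lookup x j) (A≗B i j)))

  idM-·ℚ : ∀ {d} (x : QPt d) → idM ·ℚ x ≡ x
  idM-·ℚ {d} x = lookup-ext (λ i → trans (lookup-·ℚ idM x i)
    (trans (ΣQ.Σ-single d _ i (λ k k≢i → trans (cong (λ a → ι a ℚ.* lookup x k) (idM-off i k (k≢i ∘ sym)))
                                                (ℚP.*-zeroˡ (lookup x k))))
           (trans (cong (λ a → ι a ℚ.* lookup x i) (idM-diag i)) (ℚP.*-identityˡ _))))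

  ·ℚ-injective : ∀ {d} (A : Mat d d) → InGL d A → ∀ x y → A ·ℚ x ≡ A ·ℚ y → x ≡ y
  ·ℚ-injective {d} A gl x y Ax≡Ay = begin
    x                              ≡⟨ cancel x ⟨
    inverse A ·ℚ (A ·ℚ x)          ≡⟨ cong (inverse A ·ℚ_) Ax≡Ay ⟩
    inverse A ·ℚ (A ·ℚ y)          ≡⟨ cancel y ⟩
    y                              ∎
    where
    open ≡-Reasoning
    cancel : ∀ z → inverse A ·ℚ (A ·ℚ z) ≡ z
    cancel z = trans (sym (·ℚ-·M (inverse A) A z)) (trans (·ℚ-cong z (inverse-left d A gl)) (idM-·ℚ z))

open MatrixAction

-- A map is affine when it commutes with the step
-- c·(u − v) + w from which 'affComb' builds affine combinations; such a
-- map carries coordinates with respect to a frame Q to coordinates with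
-- respect to its image, hence spans into spans, and (if injective)
-- affinely independent tuples to affinely independent tuples.
module AffineMaps where
  open import Data.Rational.Solver using (module +-*-Solver)
  open +-*-Solver using (solve; _:+_; _:*_; _:-_; :-_; _:=_)
  open import Algebra.Properties.Group ℚP.+-0-group using () renaming (∙-cancelʳ to ℚ+-cancelʳ)

  _⊕_ _⊖_ : ∀ {d} → QPt d → QPt d → QPt d
  x ⊕ y = zipWith ℚ._+_ x y
  x ⊖ y = zipWith ℚ._-_ x y

  -- one step of an affine combination: affComb q₀ (q ∷ qs) (c ∷ cs) is
  -- definitionally  step c q q₀ (affComb q₀ qs cs)
  step : ∀ {d} → ℚ → QPt d → QPt d → QPt d → QPt d
  step c u v w = V.map (c ℚ.*_) (u ⊖ v) ⊕ w

  lookup-step : ∀ {d} c (u v w : QPt d) i →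
                lookup (step c u v w) i ≡ c ℚ.* (lookup u i ℚ.- lookup v i) ℚ.+ lookup w i
  lookup-step c u v w i =
    trans (VP.lookup-zipWith ℚ._+_ i (V.map (c ℚ.*_) (u ⊖ v)) w)
          (cong (ℚ._+ lookup w i) (trans (VP.lookup-map i (c ℚ.*_) (u ⊖ v)) (cong (c ℚ.*_) (VP.lookup-zipWith ℚ._-_ i u v))))

  IsAffine : ∀ {d} → (QPt d → QPt d) → Set
  IsAffine g = ∀ c u v w → g (step c u v w) ≡ step c (g u) (g v) (g w)

  -- Coordinate vectors of Q and of map g Q have lengths that agree only
  -- propositionally; castL and uncastL are the identity relabellings.
  castL : ∀ {A B C : Set} (f : B → C) (qs : List B) → Vec A (length qs) → Vec A (length (map f qs))
  castL f []       []       = []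
  castL f (q ∷ qs) (c ∷ cs) = c ∷ castL f qs cs

  uncastL : ∀ {A B C : Set} (f : B → C) (qs : List B) → Vec A (length (map f qs)) → Vec A (length qs)
  uncastL f []       []       = []
  uncastL f (q ∷ qs) (c ∷ cs) = c ∷ uncastL f qs cs

  uncastL-castL : ∀ {A B C : Set} (f : B → C) qs (c : Vec A (length qs)) → uncastL f qs (castL f qs c) ≡ c
  uncastL-castL f []       []       = refl
  uncastL-castL f (q ∷ qs) (c ∷ cs) = cong (c ∷_) (uncastL-castL f qs cs)

  castL-uncastL : ∀ {A B C : Set} (f : B → C) qs (c : Vec A (length (map f qs))) → castL f qs (uncastL f qs c) ≡ c
  castL-uncastL f []       []       = refl
  castL-uncastL f (q ∷ qs) (c ∷ cs) = cong (c ∷_) (castL-uncastL f qs cs)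

  castL-replicate : ∀ {A B C : Set} (f : B → C) qs (a : A) → castL f qs (replicate _ a) ≡ replicate _ a
  castL-replicate f []       a = refl
  castL-replicate f (q ∷ qs) a = cong (a ∷_) (castL-replicate f qs a)

  uncastL-replicate : ∀ {A B C : Set} (f : B → C) qs (a : A) → uncastL f qs (replicate _ a) ≡ replicate _ a
  uncastL-replicate f []       a = refl
  uncastL-replicate f (q ∷ qs) a = cong (a ∷_) (uncastL-replicate f qs a)

  castC : ∀ {d} (g : QPt d → QPt d) (Q : List (QPt d)) → Vec ℚ (coordLen Q) → Vec ℚ (coordLen (map g Q))
  castC g []       c = c
  castC g (q ∷ qs) c = castL g qs c

  uncastC : ∀ {d} (g : QPt d → QPt d) (Q : List (QPt d)) → Vec ℚ (coordLen (map g Q)) → Vec ℚ (coordLen Q)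
  uncastC g []       c = c
  uncastC g (q ∷ qs) c = uncastL g qs c

  castC-uncastC : ∀ {d} (g : QPt d → QPt d) Q c → castC g Q (uncastC g Q c) ≡ c
  castC-uncastC g []       c = refl
  castC-uncastC g (q ∷ qs) c = castL-uncastL g qs c

  affComb-map : ∀ {d} {g : QPt d → QPt d} → IsAffine g →
                ∀ q₀ qs c → g (affComb q₀ qs c) ≡ affComb (g q₀) (map g qs) (castL g qs c)
  affComb-map g-aff q₀ []       []       = refl
  affComb-map {g = g} g-aff q₀ (q ∷ qs) (c ∷ cs) =
    trans (g-aff c q q₀ (affComb q₀ qs cs)) (cong (step c (g q) (g q₀)) (affComb-map g-aff q₀ qs cs))

  module Transport {d} (g : QPt d → QPt d) (g-aff : IsAffine g) where

    coords-map : ∀ Q p c → Coords Q p c → Coords (map g Q) (g p) (castC g Q c)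
    coords-map (q₀ ∷ qs) p c p≡ = trans (cong g p≡) (affComb-map g-aff q₀ qs c)

    span-map : ∀ Q p → InSpan Q p → InSpan (map g Q) (g p)
    span-map Q p (c , p≡) = castC g Q c , coords-map Q p c p≡

    indep-unmap : ∀ Q → AffIndep (map g Q) → AffIndep Q
    indep-unmap []        _   = _
    indep-unmap (q₀ ∷ qs) ind c comb≡q₀ = begin
      c                                    ≡⟨ uncastL-castL g qs c ⟨
      uncastL g qs (castL g qs c)          ≡⟨ cong (uncastL g qs) (ind (castL g qs c) image-comb) ⟩
      uncastL g qs (replicate _ ℚ.0ℚ)      ≡⟨ uncastL-replicate g qs _ ⟩
      replicate _ ℚ.0ℚ                     ∎
      where
      open ≡-Reasoning
      image-comb : affComb (g q₀) (map g qs) (castL g qs c) ≡ g q₀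
      image-comb = trans (sym (affComb-map g-aff q₀ qs c)) (cong g comb≡q₀)

    module Injective (g-inj : ∀ x y → g x ≡ g y → x ≡ y) where

      coords-unmap : ∀ Q p c → Coords (map g Q) (g p) c → Coords Q p (uncastC g Q c)
      coords-unmap (q₀ ∷ qs) p c gp≡ = g-inj _ _ (trans gp≡ (trans
        (cong (affComb (g q₀) (map g qs)) (sym (castL-uncastL g qs c)))
        (sym (affComb-map g-aff q₀ qs (uncastL g qs c)))))

      span-unmap : ∀ Q p → InSpan (map g Q) (g p) → InSpan Q p
      span-unmap Q p (c , gp≡) = uncastC g Q c , coords-unmap Q p c gp≡

      indep-map : ∀ Q → AffIndep Q → AffIndep (map g Q)
      indep-map []        _   = _
      indep-map (q₀ ∷ qs) ind c comb≡gq₀ = begin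
        c                                  ≡⟨ castL-uncastL g qs c ⟨
        castL g qs (uncastL g qs c)        ≡⟨ cong (castL g qs) (ind (uncastL g qs c) preimage-comb) ⟩
        castL g qs (replicate _ ℚ.0ℚ)      ≡⟨ castL-replicate g qs _ ⟩
        replicate _ ℚ.0ℚ                   ∎
        where
        open ≡-Reasoning
        preimage-comb : affComb q₀ qs (uncastL g qs c) ≡ q₀
        preimage-comb = g-inj _ _ (trans (affComb-map g-aff q₀ qs (uncastL g qs c))
          (trans (cong (affComb (g q₀) (map g qs)) (castL-uncastL g qs c)) comb≡gq₀))

  ·ℚ-step : ∀ {d} (A : Mat d d) c u v w → A ·ℚ step c u v w ≡ step c (A ·ℚ u) (A ·ℚ v) (A ·ℚ w)
  ·ℚ-step {d} A c u v w = lookup-ext at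
    where
    at : ∀ i → lookup (A ·ℚ step c u v w) i ≡ lookup (step c (A ·ℚ u) (A ·ℚ v) (A ·ℚ w)) i
    at i = begin
      lookup (A ·ℚ step c u v w) i
        ≡⟨ lookup-·ℚ A (step c u v w) i ⟩
      sumFinℚ d (λ j → a j ℚ.* lookup (step c u v w) j)
        ≡⟨ ΣQ.Σ-cong d (λ j → trans (cong (a j ℚ.*_) (lookup-step c u v w j))
             (solve 5 (λ a c u v w → a :* (c :* (u :- v) :+ w) := (c :* (a :* u) :+ (:- c) :* (a :* v)) :+ a :* w)
                    refl (a j) c (lookup u j) (lookup v j) (lookup w j))) ⟩
      sumFinℚ d (λ j → c ℚ.* (a j ℚ.* lookup u j) ℚ.+ (ℚ.- c) ℚ.* (a j ℚ.* lookup v j) ℚ.+ a j ℚ.* lookup w j)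
        ≡⟨ trans (ΣQ.Σ-+ d _ _) (cong (ℚ._+ Σa w)
             (trans (ΣQ.Σ-+ d _ _) (cong₂ ℚ._+_ (sym (ΣQ.Σ-*ˡ d c _)) (sym (ΣQ.Σ-*ˡ d (ℚ.- c) _))))) ⟩
      c ℚ.* Σa u ℚ.+ (ℚ.- c) ℚ.* Σa v ℚ.+ Σa w
        ≡⟨ solve 4 (λ c p q r → c :* p :+ (:- c) :* q :+ r := c :* (p :- q) :+ r) refl c (Σa u) (Σa v) (Σa w) ⟩
      c ℚ.* (Σa u ℚ.- Σa v) ℚ.+ Σa w
        ≡⟨ cong₂ (λ p r → c ℚ.* p ℚ.+ r) (cong₂ ℚ._-_ (sym (lookup-·ℚ A u i)) (sym (lookup-·ℚ A v i))) (sym (lookup-·ℚ A w i)) ⟩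
      c ℚ.* (lookup (A ·ℚ u) i ℚ.- lookup (A ·ℚ v) i) ℚ.+ lookup (A ·ℚ w) i
        ≡⟨ lookup-step c (A ·ℚ u) (A ·ℚ v) (A ·ℚ w) i ⟨
      lookup (step c (A ·ℚ u) (A ·ℚ v) (A ·ℚ w)) i ∎
      where
      open ≡-Reasoning
      a : Fin d → ℚ
      a j = ι (A i j)
      Σa : QPt d → ℚ
      Σa x = sumFinℚ d (λ j → a j ℚ.* lookup x j)

  lookup-actℚ : ∀ {d} (φ : Aff d) x i → lookup (actℚ φ x) i ≡ lookup (Aff.A φ ·ℚ x) i ℚ.+ ι (lookup (Aff.b φ) i)
  lookup-actℚ φ x i = trans (VP.lookup-zipWith ℚ._+_ i (Aff.A φ ·ℚ x) (emb (Aff.b φ)))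
                            (cong (lookup (Aff.A φ ·ℚ x) i ℚ.+_) (lookup-emb (Aff.b φ) i))

  -- x ↦ A x + b is affine: the translation cancels in u − v
  actℚ-affine : ∀ {d} (φ : Aff d) → IsAffine (actℚ φ)
  actℚ-affine {d} φ c u v w = lookup-ext at
    where
    A : Mat d d
    A = Aff.A φ
    t : Fin d → ℚ
    t i = ι (lookup (Aff.b φ) i)
    at : ∀ i → lookup (actℚ φ (step c u v w)) i ≡ lookup (step c (actℚ φ u) (actℚ φ v) (actℚ φ w)) i
    at i = begin
      lookup (actℚ φ (step c u v w)) i
        ≡⟨ lookup-actℚ φ (step c u v w) i ⟩
      lookup (A ·ℚ step c u v w) i ℚ.+ t i
        ≡⟨ cong (λ x → lookup x i ℚ.+ t i) (·ℚ-step A c u v w) ⟩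
      lookup (step c (A ·ℚ u) (A ·ℚ v) (A ·ℚ w)) i ℚ.+ t i
        ≡⟨ cong (ℚ._+ t i) (lookup-step c (A ·ℚ u) (A ·ℚ v) (A ·ℚ w) i) ⟩
      c ℚ.* (lookup (A ·ℚ u) i ℚ.- lookup (A ·ℚ v) i) ℚ.+ lookup (A ·ℚ w) i ℚ.+ t i
        ≡⟨ solve 5 (λ c a b e t → c :* (a :- b) :+ e :+ t := c :* ((a :+ t) :- (b :+ t)) :+ (e :+ t)) refl
                 c (lookup (A ·ℚ u) i) (lookup (A ·ℚ v) i) (lookup (A ·ℚ w) i) (t i) ⟩
      c ℚ.* ((lookup (A ·ℚ u) i ℚ.+ t i) ℚ.- (lookup (A ·ℚ v) i ℚ.+ t i)) ℚ.+ (lookup (A ·ℚ w) i ℚ.+ t i)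
        ≡⟨ cong₂ (λ p r → c ℚ.* p ℚ.+ r) (cong₂ ℚ._-_ (lookup-actℚ φ u i) (lookup-actℚ φ v i)) (lookup-actℚ φ w i) ⟨
      c ℚ.* (lookup (actℚ φ u) i ℚ.- lookup (actℚ φ v) i) ℚ.+ lookup (actℚ φ w) i
        ≡⟨ lookup-step c (actℚ φ u) (actℚ φ v) (actℚ φ w) i ⟨
      lookup (step c (actℚ φ u) (actℚ φ v) (actℚ φ w)) i ∎
      where open ≡-Reasoning

  actℚ-injective : ∀ {d} (φ : Aff d) x y → actℚ φ x ≡ actℚ φ y → x ≡ y
  actℚ-injective φ x y φx≡φy = ·ℚ-injective (Aff.A φ) (Aff.A∈GL φ) x y (lookup-ext (λ i → ℚ+-cancelʳ _ _ _
    (trans (sym (lookup-actℚ φ x i)) (trans (cong (λ v → lookup v i) φx≡φy) (lookup-actℚ φ y i)))))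

  emb-actℤ : ∀ {d} (φ : Aff d) z → emb (actℤ φ z) ≡ actℚ φ (emb z)
  emb-actℤ φ z = lookup-ext λ i → begin
    lookup (emb (actℤ φ z)) i                          ≡⟨ lookup-emb (actℤ φ z) i ⟩
    ι (lookup (actℤ φ z) i)                            ≡⟨ cong ι (VP.lookup-zipWith ℤ._+_ i (A ·ℤ z) (Aff.b φ)) ⟩
    ι (lookup (A ·ℤ z) i ℤ.+ lookup (Aff.b φ) i)       ≡⟨ ι-+ (lookup (A ·ℤ z) i) (lookup (Aff.b φ) i) ⟩
    ι (lookup (A ·ℤ z) i) ℚ.+ ι (lookup (Aff.b φ) i)   ≡⟨ cong (ℚ._+ ι (lookup (Aff.b φ) i))
                                                           (trans (sym (lookup-emb (A ·ℤ z) i)) (cong (λ v → lookup v i) (emb-·ℤ A z))) ⟩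
    lookup (A ·ℚ emb z) i ℚ.+ ι (lookup (Aff.b φ) i)   ≡⟨ lookup-actℚ φ (emb z) i ⟨
    lookup (actℚ φ (emb z)) i                          ∎
    where
    open ≡-Reasoning
    A : Mat _ _
    A = Aff.A φ

  emb-sub : ∀ {d} (x y : ZPt d) → emb (zipWith ℤ._-_ x y) ≡ emb x ⊖ emb y
  emb-sub x y = lookup-ext λ i → begin
    lookup (emb (zipWith ℤ._-_ x y)) i     ≡⟨ lookup-emb (zipWith ℤ._-_ x y) i ⟩
    ι (lookup (zipWith ℤ._-_ x y) i)       ≡⟨ cong ι (VP.lookup-zipWith ℤ._-_ i x y) ⟩
    ι (lookup x i ℤ.- lookup y i)          ≡⟨ trans (ι-+ (lookup x i) (ℤ.- lookup y i)) (cong (ι (lookup x i) ℚ.+_) (ι-neg (lookup y i))) ⟩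
    ι (lookup x i) ℚ.- ι (lookup y i)      ≡⟨ cong₂ ℚ._-_ (lookup-emb x i) (lookup-emb y i) ⟨
    lookup (emb x) i ℚ.- lookup (emb y) i  ≡⟨ VP.lookup-zipWith ℚ._-_ i (emb x) (emb y) ⟨
    lookup (emb x ⊖ emb y) i               ∎
    where open ≡-Reasoning

open AffineMaps

-- Writing a combination as q₀ + offset, where
-- offset is the linear part Σ cₖ (qₖ − q₀), independence of (q₀, …, qₘ)
-- says that only the zero coefficient vector has zero offset.
module AffineIndependence where
  open import Data.Rational.Solver using (module +-*-Solver)
  open +-*-Solver using (solve; con; _:+_; _:*_; _:-_; :-_; _:=_)

  offset : ∀ {d} → QPt d → (qs : List (QPt d)) → Vec ℚ (length qs) → Fin d → ℚ
  offset q₀ []       []       i = ℚ.0ℚ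
  offset q₀ (q ∷ qs) (c ∷ cs) i = c ℚ.* (lookup q i ℚ.- lookup q₀ i) ℚ.+ offset q₀ qs cs i

  lookup-affComb : ∀ {d} (q₀ : QPt d) qs c i → lookup (affComb q₀ qs c) i ≡ lookup q₀ i ℚ.+ offset q₀ qs c i
  lookup-affComb q₀ []       []       i = sym (ℚP.+-identityʳ _)
  lookup-affComb q₀ (q ∷ qs) (c ∷ cs) i =
    trans (lookup-step c q q₀ (affComb q₀ qs cs) i)
      (trans (cong (c ℚ.* (lookup q i ℚ.- lookup q₀ i) ℚ.+_) (lookup-affComb q₀ qs cs i))
             (solve 3 (λ x y z → x :+ (y :+ z) := y :+ (x :+ z)) refl
                    (c ℚ.* (lookup q i ℚ.- lookup q₀ i)) (lookup q₀ i) (offset q₀ qs cs i)))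

  offset-zero : ∀ {d} (q₀ : QPt d) qs c → affComb q₀ qs c ≡ q₀ → ∀ i → offset q₀ qs c i ≡ ℚ.0ℚ
  offset-zero q₀ qs c comb≡q₀ i =
    trans (solve 2 (λ a l → l := (a :+ l) :- a) refl (lookup q₀ i) (offset q₀ qs c i))
      (trans (cong (ℚ._- lookup q₀ i) (trans (sym (lookup-affComb q₀ qs c i)) (cong (λ v → lookup v i) comb≡q₀)))
             (ℚP.+-inverseʳ (lookup q₀ i)))

  offset-zero⁻ : ∀ {d} (q₀ : QPt d) qs c → (∀ i → offset q₀ qs c i ≡ ℚ.0ℚ) → affComb q₀ qs c ≡ q₀
  offset-zero⁻ q₀ qs c zero-offset =
    lookup-ext (λ i → trans (lookup-affComb q₀ qs c i) (trans (cong (lookup q₀ i ℚ.+_) (zero-offset i)) (ℚP.+-identityʳ _)))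

  pad : ∀ {A : Set} {xs ys : List A} → xs ⊆ ys → Vec ℚ (length xs) → Vec ℚ (length ys)
  pad []         c        = c
  pad (refl ∷ s) (c ∷ cs) = c ∷ pad s cs
  pad (y ∷ʳ s)   cs       = ℚ.0ℚ ∷ pad s cs

  offset-pad : ∀ {d} (q₀ : QPt d) {xs ys} (s : xs ⊆ ys) c i → offset q₀ ys (pad s c) i ≡ offset q₀ xs c i
  offset-pad q₀ []                       []       i = refl
  offset-pad q₀ {x ∷ xs} (refl ∷ s)      (c ∷ cs) i = cong (c ℚ.* (lookup x i ℚ.- lookup q₀ i) ℚ.+_) (offset-pad q₀ s cs i)
  offset-pad q₀ {xs}     (y ∷ʳ s)        cs       i =
    trans (cong₂ ℚ._+_ (ℚP.*-zeroˡ (lookup y i ℚ.- lookup q₀ i)) (offset-pad q₀ s cs i)) (ℚP.+-identityˡ (offset q₀ xs cs i))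

  pad-zero : ∀ {A : Set} {xs ys : List A} (s : xs ⊆ ys) c → pad s c ≡ replicate _ ℚ.0ℚ → c ≡ replicate _ ℚ.0ℚ
  pad-zero []         []       _   = refl
  pad-zero (refl ∷ s) (c ∷ cs) pad≡0 = cong₂ _∷_ (VP.∷-injectiveˡ pad≡0) (pad-zero s cs (VP.∷-injectiveʳ pad≡0))
  pad-zero (y ∷ʳ s)   cs       pad≡0 = pad-zero s cs (VP.∷-injectiveʳ pad≡0)

  indep-sublist-base : ∀ {d} (q₀ : QPt d) {xs ys} → xs ⊆ ys → AffIndep (q₀ ∷ ys) → AffIndep (q₀ ∷ xs)
  indep-sublist-base q₀ {xs} {ys} s ind c comb≡q₀ = pad-zero s c (ind (pad s c)
    (offset-zero⁻ q₀ ys (pad s c) (λ i → trans (offset-pad q₀ s c i) (offset-zero q₀ xs c comb≡q₀ i))))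

  sumV : ∀ {n} → Vec ℚ n → ℚ
  sumV []       = ℚ.0ℚ
  sumV (c ∷ cs) = c ℚ.+ sumV cs

  offset-rebase : ∀ {d} (q₀ q₁ : QPt d) qs c i →
                  offset q₀ qs c i ≡ offset q₁ qs c i ℚ.+ sumV c ℚ.* (lookup q₁ i ℚ.- lookup q₀ i)
  offset-rebase q₀ q₁ []       []       i = sym (trans (ℚP.+-identityˡ _) (ℚP.*-zeroˡ (lookup q₁ i ℚ.- lookup q₀ i)))
  offset-rebase q₀ q₁ (q ∷ qs) (c ∷ cs) i =
    trans (cong (c ℚ.* (lookup q i ℚ.- lookup q₀ i) ℚ.+_) (offset-rebase q₀ q₁ qs cs i))
      (solve 6 (λ c a b e l s → c :* (a :- e) :+ (l :+ s :* (b :- e)) := c :* (a :- b) :+ l :+ (c :+ s) :* (b :- e)) refl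
             c (lookup q i) (lookup q₁ i) (lookup q₀ i) (offset q₁ qs cs i) (sumV cs))

  -- dropping the base point keeps a tuple independent: a dependence
  -- (c) of (q₁, qs) is the dependence (−Σc, c) of (q₀, q₁, qs)
  indep-drop-base : ∀ {d} (q₀ q₁ : QPt d) qs → AffIndep (q₀ ∷ q₁ ∷ qs) → AffIndep (q₁ ∷ qs)
  indep-drop-base q₀ q₁ qs ind c comb≡q₁ = VP.∷-injectiveʳ (ind (ℚ.- sumV c ∷ c) (offset-zero⁻ q₀ (q₁ ∷ qs) (ℚ.- sumV c ∷ c) λ i →
    let δ = lookup q₁ i ℚ.- lookup q₀ i in
    trans (cong ((ℚ.- sumV c) ℚ.* δ ℚ.+_) (offset-rebase q₀ q₁ qs c i))
      (trans (cong (λ z → (ℚ.- sumV c) ℚ.* δ ℚ.+ (z ℚ.+ sumV c ℚ.* δ)) (offset-zero q₁ qs c comb≡q₁ i))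
             (solve 2 (λ s x → (:- s) :* x :+ (con ℚ.0ℚ :+ s :* x) := con ℚ.0ℚ) refl (sumV c) δ))))

  indep-sublist : ∀ {d} {xs Q : List (QPt d)} → xs ⊆ Q → AffIndep Q → AffIndep xs
  indep-sublist []              _   = _
  indep-sublist (refl ∷ s)      ind = indep-sublist-base _ s ind
  indep-sublist {xs = []}    (q₀ ∷ʳ s) ind = _
  indep-sublist {xs = x ∷ xs} (q₀ ∷ʳ s) ind = indep-drop-base q₀ x xs (indep-sublist-base q₀ s ind)

  splitV : ∀ {A : Set} {d} (qs : List (QPt d)) (p : QPt d) → Vec A (length (qs ++ p ∷ [])) → Vec A (length qs) × A
  splitV []       p (a ∷ []) = [] , a
  splitV (q ∷ qs) p (c ∷ cs) = (c ∷ proj₁ (splitV qs p cs)) , proj₂ (splitV qs p cs)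

  offset-snoc : ∀ {d} (q₀ : QPt d) qs p c i →
    offset q₀ (qs ++ p ∷ []) c i ≡ offset q₀ qs (proj₁ (splitV qs p c)) i ℚ.+ proj₂ (splitV qs p c) ℚ.* (lookup p i ℚ.- lookup q₀ i)
  offset-snoc q₀ []       p (a ∷ []) i = trans (ℚP.+-identityʳ x) (sym (ℚP.+-identityˡ x))
    where x = a ℚ.* (lookup p i ℚ.- lookup q₀ i)
  offset-snoc q₀ (q ∷ qs) p (c ∷ cs) i =
    trans (cong (c ℚ.* (lookup q i ℚ.- lookup q₀ i) ℚ.+_) (offset-snoc q₀ qs p cs i))
          (sym (ℚP.+-assoc (c ℚ.* (lookup q i ℚ.- lookup q₀ i)) _ _))

  splitV-zero : ∀ {d} (qs : List (QPt d)) p c → proj₁ (splitV qs p c) ≡ replicate _ ℚ.0ℚ →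
                proj₂ (splitV qs p c) ≡ ℚ.0ℚ → c ≡ replicate _ ℚ.0ℚ
  splitV-zero []       p (a ∷ []) _     a≡0 = cong (_∷ []) a≡0
  splitV-zero (q ∷ qs) p (c ∷ cs) cs≡0 a≡0 =
    cong₂ _∷_ (VP.∷-injectiveˡ cs≡0) (splitV-zero qs p cs (VP.∷-injectiveʳ cs≡0) a≡0)

  offset-scale : ∀ {d} (q₀ : QPt d) qs s c i → offset q₀ qs (V.map (s ℚ.*_) c) i ≡ s ℚ.* offset q₀ qs c i
  offset-scale q₀ []       s []       i = sym (ℚP.*-zeroʳ s)
  offset-scale q₀ (q ∷ qs) s (c ∷ cs) i =
    trans (cong ((s ℚ.* c) ℚ.* (lookup q i ℚ.- lookup q₀ i) ℚ.+_) (offset-scale q₀ qs s cs i))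
      (solve 4 (λ s c x l → s :* c :* x :+ s :* l := s :* (c :* x :+ l)) refl s c (lookup q i ℚ.- lookup q₀ i) (offset q₀ qs cs i))

  solve-for-point : ∀ {d} (q₀ p : QPt d) L a .{{_ : ℚ.NonZero a}} i →
    L ℚ.+ a ℚ.* (lookup p i ℚ.- lookup q₀ i) ≡ ℚ.0ℚ → lookup p i ≡ lookup q₀ i ℚ.+ (ℚ.- ℚ.1/ a) ℚ.* L
  solve-for-point q₀ p L a i dependent = sym (begin
    q ℚ.+ (ℚ.- ℚ.1/ a) ℚ.* L                  ≡⟨ cong (λ z → q ℚ.+ (ℚ.- ℚ.1/ a) ℚ.* z) L≡ ⟩
    q ℚ.+ (ℚ.- ℚ.1/ a) ℚ.* (ℚ.- (a ℚ.* x))    ≡⟨ solve 4 (λ q inv a x → q :+ (:- inv) :* (:- (a :* x)) := q :+ (a :* inv) :* x) refl q (ℚ.1/ a) a x ⟩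
    q ℚ.+ (a ℚ.* ℚ.1/ a) ℚ.* x                ≡⟨ cong (λ z → q ℚ.+ z ℚ.* x) (ℚP.*-inverseʳ a) ⟩
    q ℚ.+ ℚ.1ℚ ℚ.* x                          ≡⟨ solve 2 (λ pp q → q :+ con ℚ.1ℚ :* (pp :- q) := pp) refl (lookup p i) q ⟩
    lookup p i                                ∎)
    where
    open ≡-Reasoning
    q : ℚ
    q = lookup q₀ i
    x : ℚ
    x = lookup p i ℚ.- q
    L≡ : L ≡ ℚ.- (a ℚ.* x)
    L≡ = trans (solve 3 (λ L a x → L := (L :+ a :* x) :- a :* x) refl L a x)
               (trans (cong (ℚ._- (a ℚ.* x)) dependent) (ℚP.+-identityˡ _))

  -- appending a point p outside the span: a dependence (cs, a) of
  -- (q₀, qs ++ [p]) has a = 0 (else p would lie in the span), and then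
  -- cs = 0 by independence of (q₀, qs)
  snoc-dependence-trivial : ∀ {d} (q₀ : QPt d) qs p → AffIndep (q₀ ∷ qs) → ¬ InSpan (q₀ ∷ qs) p → ∀ cs a →
    (∀ i → offset q₀ qs cs i ℚ.+ a ℚ.* (lookup p i ℚ.- lookup q₀ i) ≡ ℚ.0ℚ) → cs ≡ replicate _ ℚ.0ℚ × a ≡ ℚ.0ℚ
  snoc-dependence-trivial q₀ qs p ind p∉ cs a dependence with a ℚP.≟ ℚ.0ℚ
  ... | yes a≡0 = ind cs (offset-zero⁻ q₀ qs cs λ i → begin
          offset q₀ qs cs i                                        ≡⟨ ℚP.+-identityʳ _ ⟨
          offset q₀ qs cs i ℚ.+ ℚ.0ℚ                               ≡⟨ cong (offset q₀ qs cs i ℚ.+_) last-term≡0 ⟨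
          offset q₀ qs cs i ℚ.+ a ℚ.* (lookup p i ℚ.- lookup q₀ i) ≡⟨ dependence i ⟩
          ℚ.0ℚ                                                     ∎) , a≡0
    where
    open ≡-Reasoning
    last-term≡0 : ∀ {i} → a ℚ.* (lookup p i ℚ.- lookup q₀ i) ≡ ℚ.0ℚ
    last-term≡0 {i} = trans (cong (ℚ._* _) a≡0) (ℚP.*-zeroˡ (lookup p i ℚ.- lookup q₀ i))
  ... | no a≢0 = ⊥-elim (p∉ (V.map (b ℚ.*_) cs , lookup-ext λ i →
          trans (solve-for-point q₀ p (offset q₀ qs cs i) a i (dependence i))
            (trans (cong (lookup q₀ i ℚ.+_) (sym (offset-scale q₀ qs b cs i))) (sym (lookup-affComb q₀ qs (V.map (b ℚ.*_) cs) i)))))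
    where
    instance
      a-nonZero : ℚ.NonZero a
      a-nonZero = ℚ.≢-nonZero a≢0
    b : ℚ
    b = ℚ.- ℚ.1/ a

  indep-snoc : ∀ {d} (q₀ : QPt d) qs p → AffIndep (q₀ ∷ qs) → ¬ InSpan (q₀ ∷ qs) p → AffIndep (q₀ ∷ (qs ++ p ∷ []))
  indep-snoc q₀ qs p ind p∉ c comb≡q₀ =
    let (cs≡0 , a≡0) = snoc-dependence-trivial q₀ qs p ind p∉ (proj₁ (splitV qs p c)) (proj₂ (splitV qs p c))
                         (λ i → trans (sym (offset-snoc q₀ qs p c i)) (offset-zero q₀ (qs ++ p ∷ []) c comb≡q₀ i))
    in splitV-zero qs p c cs≡0 a≡0

open AffineIndependence

module IntegerFacts where
  open import Data.Integer using (+_; -[1+_]; _+_; _*_; _≤_; _<_; +<+; +≤+; 0ℤ)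
  open import Data.Nat.Divisibility using (divides; ∣-antisym)
  open import Data.Integer.Solver using (module +-*-Solver)
  open +-*-Solver using (solve; _:+_; _:*_; :-_; _:=_)

  *-cancelʳ-pos : ∀ {p} α β → 0ℤ < p → α * p ≡ β * p → α ≡ β
  *-cancelʳ-pos {+ suc n} α β _        αp≡βp = ℤP.*-cancelʳ-≡ α β (+ suc n) αp≡βp
  *-cancelʳ-pos {+ zero}  α β (+<+ ()) _

  *-pos-zero : ∀ {p} α → 0ℤ < p → α * p ≡ 0ℤ → α ≡ 0ℤ
  *-pos-zero α p>0 αp≡0 = *-cancelʳ-pos α 0ℤ p>0 αp≡0

  pos-associates : ∀ {a b} x y → 0ℤ < a → 0ℤ < b → a ≡ x * b → b ≡ y * a → a ≡ b
  pos-associates {+ suc a} {+ suc b} x y _ _ a≡xb b≡ya =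
    cong +_ (∣-antisym (divides ℤ.∣ y ∣ (trans (cong ℤ.∣_∣ b≡ya) (ℤP.abs-* y (+ suc a))))
                       (divides ℤ.∣ x ∣ (trans (cong ℤ.∣_∣ a≡xb) (ℤP.abs-* x (+ suc b)))))
  pos-associates {+ zero}            x y (+<+ ()) _        _ _
  pos-associates {+ suc a} {+ zero}  x y _        (+<+ ()) _ _

  below-modulus : ∀ m n p t → + m < + suc p → + m ≡ + n + (+ suc t) * (+ suc p) → ⊥
  below-modulus m n p t (+<+ m<P) m≡ = ℕP.<-irrefl refl (ℕP.<-≤-trans m<P
    (ℕP.≤-trans (ℕP.m≤n*m (suc p) (suc t)) (ℕP.≤-trans (ℕP.m≤n+m _ n) (ℕP.≤-reflexive (sym (ℤP.+-injective m≡))))))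

  residues-differ-by-0 : ∀ {x y P} a → 0ℤ ≤ x → x < P → 0ℤ ≤ y → y < P → x ≡ y + a * P → a ≡ 0ℤ
  residues-differ-by-0 (+ zero) _ _ _ _ _ = refl
  residues-differ-by-0 {+ m} {+ n} {+ suc p} (+ suc t) (+≤+ _) x<P (+≤+ _) y<P x≡ =
    ⊥-elim (below-modulus m n p t x<P x≡)
  residues-differ-by-0 {+ m} {+ n} {+ suc p} -[1+ t ] (+≤+ _) x<P (+≤+ _) y<P x≡ =
    ⊥-elim (below-modulus n m p t y<P
      (trans (solve 3 (λ y a P → y := (y :+ a :* P) :+ (:- a) :* P) refl (+ n) -[1+ t ] (+ suc p))
             (cong (λ z → z + (+ suc t) * (+ suc p)) (sym x≡))))
  residues-differ-by-0 {+ m} {+ n} { -[1+ p ]} a _ () _ _ _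
  residues-differ-by-0 {+ m} {+ n} {+ zero}    a _ (+<+ ()) _ _ _

open IntegerFacts

-- Every row of H' is an integer combination of the nonzero rows of H
-- (and vice versa); comparing leading entries shows that the two have
-- the same pivot columns with the same pivot values, and the reduction
-- of the entries above each pivot forces the combinations to be trivial.
module HermiteUniqueness where
  open import Data.Integer using (_+_; _*_; -_; _-_; _≤_; _<_; 0ℤ; 1ℤ)
  open import Data.Fin using (inject≤) renaming (_<_ to _<F_)
  open import Data.Integer.Solver using (module +-*-Solver)
  open +-*-Solver using (solve; _:+_; _:*_; _:-_; :-_; _:=_)

  Σ-truncate : ∀ {r d} (r≤d : r ℕ.≤ d) (f : Fin d → ℤ) → (∀ m → r ℕ.≤ toℕ m → f m ≡ 0ℤ) →
               sumFin d f ≡ sumFin r (λ l → f (inject≤ l r≤d))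
  Σ-truncate {zero}  {d}     r≤d         f tail≡0 = ΣZ.Σ-zeros d f (λ m → tail≡0 m ℕ.z≤n)
  Σ-truncate {suc r} {suc d} (ℕ.s≤s r≤d) f tail≡0 =
    cong (f zero +_) (Σ-truncate r≤d (f ∘ suc) (λ m r≤m → tail≡0 (suc m) (ℕ.s≤s r≤m)))

  first-nonzero : ∀ n (α : Fin n → ℤ) →
    (∀ l → α l ≡ 0ℤ) ⊎ Σ (Fin n) (λ l → ¬ α l ≡ 0ℤ × (∀ l' → toℕ l' ℕ.< toℕ l → α l' ≡ 0ℤ))
  first-nonzero zero    α = inj₁ (λ ())
  first-nonzero (suc n) α with α zero ℤP.≟ 0ℤ
  ... | no α₀≢0 = inj₂ (zero , α₀≢0 , (λ l' ()))
  ... | yes α₀≡0 with first-nonzero n (α ∘ suc)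
  ...   | inj₁ rest≡0             = inj₁ (λ { zero → α₀≡0 ; (suc l) → rest≡0 l })
  ...   | inj₂ (l , αl≢0 , before) = inj₂ (suc l , αl≢0 , (λ { zero _ → α₀≡0 ; (suc l') (ℕ.s≤s l'<l) → before l' l'<l }))

  module Echelon {d k} (H : Mat d k) (r : ℕ) (r≤d : r ℕ.≤ d) (piv : Fin r → Fin k)
    (mono : ∀ i i' → i <F i' → toℕ (piv i) ℕ.< toℕ (piv i'))
    (pos : ∀ i → 0ℤ < H (inject≤ i r≤d) (piv i))
    (left-zero : ∀ i j → toℕ j ℕ.< toℕ (piv i) → H (inject≤ i r≤d) j ≡ 0ℤ)
    (low-zero : ∀ i j → r ℕ.≤ toℕ i → H i j ≡ 0ℤ) where

    row : Fin r → Fin d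
    row i = inject≤ i r≤d

    comb : (Fin r → ℤ) → Fin k → ℤ
    comb α j = sumFin r (λ l → α l * H (row l) j)

    comb-of-all-rows : ∀ (a : Fin d → ℤ) j → sumFin d (λ m → a m * H m j) ≡ comb (λ l → a (row l)) j
    comb-of-all-rows a j = Σ-truncate r≤d (λ m → a m * H m j)
      (λ m r≤m → trans (cong (a m *_) (low-zero m j r≤m)) (ℤP.*-zeroʳ (a m)))

    piv-mono-≤ : ∀ l l' → toℕ l ℕ.≤ toℕ l' → toℕ (piv l) ℕ.≤ toℕ (piv l')
    piv-mono-≤ l l' l≤l' with ℕP.<-cmp (toℕ l) (toℕ l')
    ... | tri< l<l' _ _ = ℕP.<⇒≤ (mono l l' l<l')
    ... | tri≈ _ l≡l' _ = ℕP.≤-reflexive (cong (toℕ ∘ piv) (FinP.toℕ-injective l≡l'))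
    ... | tri> _ _ l>l' = ⊥-elim (ℕP.<-irrefl refl (ℕP.<-≤-trans l>l' l≤l'))

    comb-left-zero : ∀ α l → (∀ l' → toℕ l' ℕ.< toℕ l → α l' ≡ 0ℤ) →
                     ∀ j → toℕ j ℕ.< toℕ (piv l) → comb α j ≡ 0ℤ
    comb-left-zero α l before j j<piv = ΣZ.Σ-zeros r _ term≡0
      where
      term≡0 : ∀ l' → α l' * H (row l') j ≡ 0ℤ
      term≡0 l' with toℕ l' ℕP.<? toℕ l
      ... | yes l'<l = cong (_* H (row l') j) (before l' l'<l)
      ... | no  l'≮l = trans (cong (α l' *_) (left-zero l' j (ℕP.<-≤-trans j<piv (piv-mono-≤ l l' (ℕP.≮⇒≥ l'≮l)))))
                             (ℤP.*-zeroʳ (α l'))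

    comb-at-pivot : ∀ α l → (∀ l' → toℕ l' ℕ.< toℕ l → α l' ≡ 0ℤ) → comb α (piv l) ≡ α l * H (row l) (piv l)
    comb-at-pivot α l before = ΣZ.Σ-single r _ l term≡0
      where
      term≡0 : ∀ l' → ¬ l' ≡ l → α l' * H (row l') (piv l) ≡ 0ℤ
      term≡0 l' l'≢l with ℕP.<-cmp (toℕ l') (toℕ l)
      ... | tri< l'<l _ _ = cong (_* H (row l') (piv l)) (before l' l'<l)
      ... | tri≈ _ l'≡l _ = ⊥-elim (l'≢l (FinP.toℕ-injective l'≡l))
      ... | tri> _ _ l'>l = trans (cong (α l' *_) (left-zero l' (piv l) (mono l l' l'>l))) (ℤP.*-zeroʳ (α l'))

    leading-coeffs-zero : ∀ α i → (∀ j → toℕ j ℕ.< toℕ (piv i) → comb α j ≡ 0ℤ) →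
                          ∀ l → toℕ l ℕ.< toℕ i → α l ≡ 0ℤ
    leading-coeffs-zero α i comb≡0 l l<i = by-induction (suc (toℕ l)) l (ℕP.n<1+n _) l<i
      where
      by-induction : ∀ n l → toℕ l ℕ.< n → toℕ l ℕ.< toℕ i → α l ≡ 0ℤ
      by-induction (suc n) l (ℕ.s≤s l≤n) l<i =
        let before = λ l' l'<l → by-induction n l' (ℕP.<-≤-trans l'<l l≤n) (ℕP.<-trans l'<l l<i)
        in *-pos-zero (α l) (pos l) (trans (sym (comb-at-pivot α l before)) (comb≡0 (piv l) (mono l i l<i)))

  module SameImage {r r' k : ℕ} (f : Fin r → Fin k) (g : Fin r' → Fin k)
    (f-mono : ∀ i i' → i <F i' → toℕ (f i) ℕ.< toℕ (f i'))
    (g-mono : ∀ i i' → i <F i' → toℕ (g i) ℕ.< toℕ (g i'))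
    (f⊇g : ∀ i' → Σ (Fin r) (λ i → f i ≡ g i'))
    (g⊇f : ∀ i → Σ (Fin r') (λ i' → g i' ≡ f i)) where

    strictly-increasing-injective : ∀ {n} (h : Fin n → Fin k) → (∀ i i' → i <F i' → toℕ (h i) ℕ.< toℕ (h i')) →
                                    ∀ a b → h a ≡ h b → a ≡ b
    strictly-increasing-injective h h-mono a b ha≡hb with ℕP.<-cmp (toℕ a) (toℕ b)
    ... | tri< a<b _ _ = ⊥-elim (ℕP.<-irrefl (cong toℕ ha≡hb) (h-mono a b a<b))
    ... | tri≈ _ a≡b _ = FinP.toℕ-injective a≡b
    ... | tri> _ _ a>b = ⊥-elim (ℕP.<-irrefl (cong toℕ (sym ha≡hb)) (h-mono b a a>b))

    f-reflects-< : ∀ a b → toℕ (f a) ℕ.< toℕ (f b) → toℕ a ℕ.< toℕ b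
    f-reflects-< a b fa<fb with ℕP.<-cmp (toℕ a) (toℕ b)
    ... | tri< a<b _ _ = a<b
    ... | tri≈ _ a≡b _ = ⊥-elim (ℕP.<-irrefl (cong (toℕ ∘ f) (FinP.toℕ-injective a≡b)) fa<fb)
    ... | tri> _ _ a>b = ⊥-elim (ℕP.<-asym fa<fb (f-mono b a a>b))

    match : ∀ i → Σ (Fin r') (λ i' → toℕ i' ≡ toℕ i × g i' ≡ f i)
    match i = by-induction (suc (toℕ i)) i (ℕP.n<1+n _)
      where
      by-induction : ∀ n i → toℕ i ℕ.< n → Σ (Fin r') (λ i' → toℕ i' ≡ toℕ i × g i' ≡ f i)
      by-induction (suc n) i (ℕ.s≤s i≤n) with g⊇f i
      ... | j' , gj'≡fi with ℕP.<-cmp (toℕ j') (toℕ i)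
      ...   | tri≈ _ j'≡i _ = j' , j'≡i , gj'≡fi
      -- j' < i: index i₀ = j' is already matched with j', so f i₀ = g j' = f i, against injectivity of f
      ...   | tri< j'<i _ _ =
              let i₀<r = ℕP.<-trans j'<i (FinP.toℕ<n i)
                  i₀ = fromℕ< i₀<r
                  toℕ-i₀ = FinP.toℕ-fromℕ< i₀<r
                  (i₀' , i₀'≡i₀ , gi₀'≡fi₀) = by-induction n i₀ (ℕP.≤-trans (ℕP.≤-reflexive (cong suc toℕ-i₀)) (ℕP.≤-trans j'<i i≤n))
                  i₀'≡j' = FinP.toℕ-injective (trans i₀'≡i₀ toℕ-i₀)
                  i₀≡i = strictly-increasing-injective f f-mono i₀ i (trans (sym gi₀'≡fi₀) (trans (cong g i₀'≡j') gj'≡fi))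
              in ⊥-elim (ℕP.<-irrefl (trans (sym toℕ-i₀) (cong toℕ i₀≡i)) j'<i)
      -- j' > i: g i' (index i' = i) lies below g j' = f i, so it is f m with m < i;
      -- but m is matched with index m ≠ i', against injectivity of g
      ...   | tri> _ _ i<j' =
              let i'<r' = ℕP.<-trans i<j' (FinP.toℕ<n j')
                  i' = fromℕ< i'<r'
                  toℕ-i' = FinP.toℕ-fromℕ< i'<r'
                  (m , fm≡gi') = f⊇g i'
                  gi'<gj' = g-mono i' j' (ℕP.≤-trans (ℕP.≤-reflexive (cong suc toℕ-i')) i<j')
                  m<i = f-reflects-< m i (ℕP.<-≤-trans (ℕP.≤-trans (ℕP.≤-reflexive (cong (suc ∘ toℕ) fm≡gi')) gi'<gj')
                                                      (ℕP.≤-reflexive (cong toℕ gj'≡fi)))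
                  (m' , m'≡m , gm'≡fm) = by-induction n m (ℕP.<-≤-trans m<i i≤n)
                  m'≡i' = strictly-increasing-injective g g-mono m' i' (trans gm'≡fm fm≡gi')
              in ⊥-elim (ℕP.<-irrefl (trans (sym m'≡m) (trans (cong toℕ m'≡i') toℕ-i')) m<i)

  module LeftMultiple {d k} (H₁ : Mat d k) (r₁ : ℕ) (r₁≤d : r₁ ℕ.≤ d) (piv₁ : Fin r₁ → Fin k)
    (mono₁ : ∀ i i' → i <F i' → toℕ (piv₁ i) ℕ.< toℕ (piv₁ i'))
    (pos₁ : ∀ i → 0ℤ < H₁ (inject≤ i r₁≤d) (piv₁ i))
    (left-zero₁ : ∀ i j → toℕ j ℕ.< toℕ (piv₁ i) → H₁ (inject≤ i r₁≤d) j ≡ 0ℤ)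
    (low-zero₁ : ∀ i j → r₁ ℕ.≤ toℕ i → H₁ i j ≡ 0ℤ)
    (H₂ : Mat d k) (r₂ : ℕ) (r₂≤d : r₂ ℕ.≤ d) (piv₂ : Fin r₂ → Fin k)
    (pos₂ : ∀ i → 0ℤ < H₂ (inject≤ i r₂≤d) (piv₂ i))
    (left-zero₂ : ∀ i j → toℕ j ℕ.< toℕ (piv₂ i) → H₂ (inject≤ i r₂≤d) j ≡ 0ℤ)
    (W : Mat d d) (H₂≡WH₁ : ∀ i j → H₂ i j ≡ (W ·M H₁) i j) where
    module E₁ = Echelon H₁ r₁ r₁≤d piv₁ mono₁ pos₁ left-zero₁ low-zero₁

    row₂ : Fin r₂ → Fin d
    row₂ i = inject≤ i r₂≤d

    α : Fin r₂ → Fin r₁ → ℤ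
    α i₂ l = W (row₂ i₂) (E₁.row l)

    row-comb : ∀ i₂ j → H₂ (row₂ i₂) j ≡ E₁.comb (α i₂) j
    row-comb i₂ j = trans (H₂≡WH₁ (row₂ i₂) j) (E₁.comb-of-all-rows (W (row₂ i₂)) j)

    -- the pivot of row i₂ of H₂ is the pivot of the first row of H₁ used by α i₂
    pivot-is-pivot : ∀ i₂ → Σ (Fin r₁) (λ l → piv₁ l ≡ piv₂ i₂)
    pivot-is-pivot i₂ with first-nonzero r₁ (α i₂)
    ... | inj₁ α≡0 = ⊥-elim (ℤP.<-irrefl (sym (trans (row-comb i₂ (piv₂ i₂))
                              (ΣZ.Σ-zeros r₁ _ (λ l → cong (_* H₁ (E₁.row l) (piv₂ i₂)) (α≡0 l))))) (pos₂ i₂))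
    ... | inj₂ (l , αl≢0 , before) with ℕP.<-cmp (toℕ (piv₂ i₂)) (toℕ (piv₁ l))
    ...   | tri≈ _ same _ = l , FinP.toℕ-injective (sym same)
    ...   | tri< p₂<p₁ _ _ = ⊥-elim (ℤP.<-irrefl (sym (trans (row-comb i₂ (piv₂ i₂))
                               (E₁.comb-left-zero (α i₂) l before (piv₂ i₂) p₂<p₁))) (pos₂ i₂))
    ...   | tri> _ _ p₁<p₂ = ⊥-elim (αl≢0 (*-pos-zero (α i₂ l) (pos₁ l)
                               (trans (sym (E₁.comb-at-pivot (α i₂) l before))
                                      (trans (sym (row-comb i₂ (piv₁ l))) (left-zero₂ i₂ (piv₁ l) p₁<p₂)))))

    α-leading-zero : ∀ i₁ i₂ → piv₁ i₁ ≡ piv₂ i₂ → ∀ l → toℕ l ℕ.< toℕ i₁ → α i₂ l ≡ 0ℤ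
    α-leading-zero i₁ i₂ same-piv = E₁.leading-coeffs-zero (α i₂) i₁
      (λ j j<p → trans (sym (row-comb i₂ j)) (left-zero₂ i₂ j (subst (λ p → toℕ j ℕ.< toℕ p) same-piv j<p)))

    pivot-multiple : ∀ i₁ i₂ → piv₁ i₁ ≡ piv₂ i₂ → H₂ (row₂ i₂) (piv₂ i₂) ≡ α i₂ i₁ * H₁ (E₁.row i₁) (piv₁ i₁)
    pivot-multiple i₁ i₂ same-piv =
      trans (cong (H₂ (row₂ i₂)) (sym same-piv))
            (trans (row-comb i₂ (piv₁ i₁)) (E₁.comb-at-pivot (α i₂) i₁ (α-leading-zero i₁ i₂ same-piv)))

  module Compare {d k} (H H' : Mat d k) (U V : Mat d d)
    (r : ℕ) (r≤d : r ℕ.≤ d) (piv : Fin r → Fin k)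
    (mono : ∀ i i' → i <F i' → toℕ (piv i) ℕ.< toℕ (piv i'))
    (pos : ∀ i → 0ℤ < H (inject≤ i r≤d) (piv i))
    (left-zero : ∀ i j → toℕ j ℕ.< toℕ (piv i) → H (inject≤ i r≤d) j ≡ 0ℤ)
    (low-zero : ∀ i j → r ℕ.≤ toℕ i → H i j ≡ 0ℤ)
    (reduced : ∀ i i' → i <F i' → (0ℤ ≤ H (inject≤ i r≤d) (piv i')) × (H (inject≤ i r≤d) (piv i') < H (inject≤ i' r≤d) (piv i')))
    (r' : ℕ) (r'≤d : r' ℕ.≤ d) (piv' : Fin r' → Fin k)
    (mono' : ∀ i i' → i <F i' → toℕ (piv' i) ℕ.< toℕ (piv' i'))
    (pos' : ∀ i → 0ℤ < H' (inject≤ i r'≤d) (piv' i))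
    (left-zero' : ∀ i j → toℕ j ℕ.< toℕ (piv' i) → H' (inject≤ i r'≤d) j ≡ 0ℤ)
    (low-zero' : ∀ i j → r' ℕ.≤ toℕ i → H' i j ≡ 0ℤ)
    (reduced' : ∀ i i' → i <F i' → (0ℤ ≤ H' (inject≤ i r'≤d) (piv' i')) × (H' (inject≤ i r'≤d) (piv' i') < H' (inject≤ i' r'≤d) (piv' i')))
    (H'≡UH : ∀ i j → H' i j ≡ (U ·M H) i j) (H≡VH' : ∀ i j → H i j ≡ (V ·M H') i j) where

    module E  = Echelon H r r≤d piv mono pos left-zero low-zero
    module M₁ = LeftMultiple H r r≤d piv mono pos left-zero low-zero H' r' r'≤d piv' pos' left-zero' U H'≡UH
    module M₂ = LeftMultiple H' r' r'≤d piv' mono' pos' left-zero' low-zero' H r r≤d piv pos left-zero V H≡VH'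
    module S  = SameImage piv piv' mono mono' M₁.pivot-is-pivot M₂.pivot-is-pivot
    module S' = SameImage piv' piv mono' mono M₂.pivot-is-pivot M₁.pivot-is-pivot

    row : Fin r → Fin d
    row = E.row

    row' : Fin r' → Fin d
    row' i = inject≤ i r'≤d

    -- equal pivot columns carry equal (positive, mutually dividing) pivots
    pivot-values : ∀ i i' → piv i ≡ piv' i' → H (row i) (piv i) ≡ H' (row' i') (piv' i')
    pivot-values i i' same-piv = sym (pos-associates (M₁.α i' i) (M₂.α i i') (pos' i') (pos i)
      (M₁.pivot-multiple i i' same-piv) (M₂.pivot-multiple i' i (sym same-piv)))

    module RowDifference (i : Fin r) (i' : Fin r') (same-index : toℕ i ≡ toℕ i') (same-piv : piv i ≡ piv' i') where
      β : Fin r → ℤ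
      β l = M₁.α i' l - idM l i

      comb-β : ∀ j → E.comb β j ≡ H' (row' i') j - H (row i) j
      comb-β j = begin
        sumFin r (λ l → (M₁.α i' l - idM l i) * H (row l) j)
          ≡⟨ ΣZ.Σ-cong r (λ l → solve 3 (λ a u h → (a :- u) :* h := a :* h :+ :- (u :* h)) refl (M₁.α i' l) (idM l i) (H (row l) j)) ⟩
        sumFin r (λ l → M₁.α i' l * H (row l) j + - (idM l i * H (row l) j))
          ≡⟨ ΣZ.Σ-+ r _ _ ⟩
        E.comb (M₁.α i') j + sumFin r (λ l → - (idM l i * H (row l) j))
          ≡⟨ cong₂ _+_ (sym (M₁.row-comb i' j)) (trans (ΣZ.Σ-neg r _) (cong -_ row-i)) ⟩
        H' (row' i') j - H (row i) j ∎
        where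
        open ≡-Reasoning
        row-i : sumFin r (λ l → idM l i * H (row l) j) ≡ H (row i) j
        row-i = trans (ΣZ.Σ-single r _ i (λ l l≢i → cong (_* H (row l) j) (idM-off l i l≢i)))
                      (trans (cong (_* H (row i) j) (idM-diag i)) (ℤP.*-identityˡ _))

      α-at-i : M₁.α i' i ≡ 1ℤ
      α-at-i = *-cancelʳ-pos (M₁.α i' i) 1ℤ (pos i)
        (trans (sym (M₁.pivot-multiple i i' same-piv)) (trans (sym (pivot-values i i' same-piv)) (sym (ℤP.*-identityˡ _))))

      -- β l = 0 by induction on l: for l < i by the leading zeros, at
      -- l = i since α i = 1, and for l > i because column piv l of both
      -- rows is reduced modulo the same pivot
      β-zero : ∀ l → β l ≡ 0ℤ
      β-zero l = by-induction (suc (toℕ l)) l (ℕP.n<1+n _)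
        where
        by-induction : ∀ n l → toℕ l ℕ.< n → β l ≡ 0ℤ
        by-induction (suc n) l (ℕ.s≤s l≤n) with ℕP.<-cmp (toℕ l) (toℕ i)
        ... | tri< l<i _ _ = cong₂ _-_ (M₁.α-leading-zero i i' same-piv l l<i) (idM-off l i (λ l≡i → ℕP.<-irrefl (cong toℕ l≡i) l<i))
        ... | tri≈ _ l≡i _ rewrite FinP.toℕ-injective l≡i = cong₂ _-_ α-at-i (idM-diag i)
        ... | tri> _ _ i<l =
          let before = λ l' l'<l → by-induction n l' (ℕP.<-≤-trans l'<l l≤n)
              (l' , l'≡l , piv'l'≡pivl) = S.match l
              x = H' (row' i') (piv l)
              y = H (row i) (piv l)
              P = H (row l) (piv l)
              x≡ : x ≡ y + β l * P
              x≡ = trans (solve 2 (λ x y → x := y :+ (x :- y)) refl x y)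
                         (cong (y +_) (trans (sym (comb-β (piv l))) (E.comb-at-pivot β l before)))
              (0≤y , y<P) = reduced i l i<l
              (0≤x' , x'<P') = reduced' i' l' (subst (ℕ._< toℕ l') same-index (subst (toℕ i ℕ.<_) (sym l'≡l) i<l))
              0≤x = subst (λ p → 0ℤ ≤ H' (row' i') p) piv'l'≡pivl 0≤x'
              x<P = subst₂ _<_ (cong (H' (row' i')) piv'l'≡pivl) (sym (pivot-values l l' (sym piv'l'≡pivl))) x'<P'
          in residues-differ-by-0 (β l) 0≤x x<P 0≤y y<P x≡

      rows-equal : ∀ j → H (row i) j ≡ H' (row' i') j
      rows-equal j = sym (begin
        H' (row' i') j                               ≡⟨ solve 2 (λ x y → x := y :+ (x :- y)) refl (H' (row' i') j) (H (row i) j) ⟩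
        H (row i) j + (H' (row' i') j - H (row i) j) ≡⟨ cong (H (row i) j +_) (sym (comb-β j)) ⟩
        H (row i) j + E.comb β j                     ≡⟨ cong (H (row i) j +_) (ΣZ.Σ-zeros r _ (λ l → cong (_* H (row l) j) (β-zero l))) ⟩
        H (row i) j + 0ℤ                             ≡⟨ ℤP.+-identityʳ _ ⟩
        H (row i) j                                  ∎)
        where open ≡-Reasoning

    equal : ∀ m j → H m j ≡ H' m j
    equal m j with toℕ m ℕP.<? r
    ... | yes m<r =
      let i = fromℕ< m<r
          (i' , i'≡i , piv'≡piv) = S.match i
          row-i≡m : row i ≡ m
          row-i≡m = FinP.toℕ-injective (trans (FinP.toℕ-inject≤ i r≤d) (FinP.toℕ-fromℕ< m<r))
          row'-i'≡m : row' i' ≡ m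
          row'-i'≡m = FinP.toℕ-injective (trans (FinP.toℕ-inject≤ i' r'≤d) (trans i'≡i (FinP.toℕ-fromℕ< m<r)))
      in subst₂ (λ a b → H a j ≡ H' b j) row-i≡m row'-i'≡m (RowDifference.rows-equal i i' (sym i'≡i) (sym piv'≡piv) j)
    ... | no m≮r with toℕ m ℕP.<? r'
    ...   | yes m<r' =
      let (i , i≡ , _) = S'.match (fromℕ< m<r')
      in ⊥-elim (m≮r (subst (ℕ._< r) (trans i≡ (FinP.toℕ-fromℕ< m<r')) (FinP.toℕ<n i)))
    ...   | no m≮r' = trans (low-zero m j (ℕP.≮⇒≥ m≮r)) (sym (low-zero' m j (ℕP.≮⇒≥ m≮r')))

  hnf-unique : ∀ {d k} (H H' : Mat d k) (U V : Mat d d) → IsHNF H → IsHNF H' →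
               (∀ i j → H' i j ≡ (U ·M H) i j) → (∀ i j → H i j ≡ (V ·M H') i j) → ∀ i j → H i j ≡ H' i j
  hnf-unique H H' U V (r , r≤d , piv , mono , pos , lz , bz , red) (r' , r'≤d , piv' , mono' , pos' , lz' , bz' , red') =
    Compare.equal H H' U V r r≤d piv mono pos lz bz red r' r'≤d piv' mono' pos' lz' bz' red'

open HermiteUniqueness using (hnf-unique)

-- Step 2 is
-- deterministic since the lexicographic order on coordinates is
-- antisymmetric and coordinates determine points; the tuple T it
-- produces consists of affinely independent points of Λ and, having
-- maximal length dim Span(Λ) + 1, spans every point of Λ.
module SingleRun where

  LexLe-antisym : ∀ {m} (x y : Vec ℚ m) → LexLe x y → LexLe y x → x ≡ y
  LexLe-antisym []       []       _                _                 = refl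
  LexLe-antisym (x ∷ xs) (y ∷ ys) (inj₁ x<y)       (inj₁ y<x)        = ⊥-elim (ℚP.<-asym x<y y<x)
  LexLe-antisym (x ∷ xs) (y ∷ ys) (inj₁ x<y)       (inj₂ (y≡x , _))  = ⊥-elim (ℚP.<-irrefl (sym y≡x) x<y)
  LexLe-antisym (x ∷ xs) (y ∷ ys) (inj₂ (x≡y , _)) (inj₁ y<x)        = ⊥-elim (ℚP.<-irrefl (sym x≡y) y<x)
  LexLe-antisym (x ∷ xs) (y ∷ ys) (inj₂ (x≡y , xs≤ys)) (inj₂ (_ , ys≤xs)) = cong₂ _∷_ x≡y (LexLe-antisym xs ys xs≤ys ys≤xs)

  next-unique : ∀ {d} (Λ : List (ZPt d)) Q T a b → (∀ z → z ∈ Λ → InSpan Q (emb z)) →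
                IsNext Λ Q T a → IsNext Λ Q T b → a ≡ b
  next-unique Λ Q T a b Λ⊆span (a∈ , a∉ , a-min) (b∈ , b∉ , b-min) with Λ⊆span a a∈ | Λ⊆span b b∈
  ... | (ca , a≡) | (cb , b≡) =
    emb-injective a b (same-coords Q a≡ b≡ (LexLe-antisym ca cb (a-min b b∈ b∉ ca cb a≡ b≡) (b-min a a∈ a∉ cb ca b≡ a≡)))
    where
    same-coords : ∀ Q {ca cb} → Coords Q (emb a) ca → Coords Q (emb b) cb → ca ≡ cb → emb a ≡ emb b
    same-coords (q₀ ∷ qs) a≡ b≡ refl = trans a≡ (sym b≡)

  extend-length : ∀ {d} {Λ : List (ZPt d)} {Q n T T₁} → Extend Λ Q n T T₁ → length T₁ ≡ n
  extend-length (ext-done len) = len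
  extend-length (ext-step _ _ _ rest) = extend-length rest

  indep-snocℤ : ∀ {d} (T : List (ZPt d)) p → AffIndep (map emb T) → ¬ InSpanℤ T p → AffIndep (map emb (T ++ p ∷ []))
  indep-snocℤ []      p _   _  = λ { [] _ → refl }
  indep-snocℤ (t ∷ T) p ind p∉ = subst (λ X → AffIndep (emb t ∷ X)) (sym (LP.map-++ emb T (p ∷ [])))
                                       (indep-snoc (emb t) (map emb T) (emb p) ind p∉)

  init-sublist : ∀ {d} {Λ : List (ZPt d)} {Q T} → InitT Λ Q T → map emb T ⊆ Q × All (_∈ Λ) T
  init-sublist init-[]            = [] , []
  init-sublist (init-keep z z∈ r) = let (s , T⊆Λ) = init-sublist r in (refl ∷ s) , (z∈ ∷ T⊆Λ)
  init-sublist (init-skip q _ r)  = let (s , T⊆Λ) = init-sublist r in (q ∷ʳ s) , T⊆Λ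

  extend-invariant : ∀ {d} {Λ : List (ZPt d)} {Q n T T₁} → Extend Λ Q n T T₁ →
                     All (_∈ Λ) T → AffIndep (map emb T) → All (_∈ Λ) T₁ × AffIndep (map emb T₁)
  extend-invariant (ext-done _) T⊆Λ ind = T⊆Λ , ind
  extend-invariant {T = T} (ext-step p _ (p∈ , p∉ , _) rest) T⊆Λ ind =
    extend-invariant rest (AllP.++⁺ T⊆Λ (p∈ ∷ [])) (indep-snocℤ T p ind p∉)

  run-invariant : ∀ {d} {Λ : List (ZPt d)} {Q n T₀ T} → Frame Q → InitT Λ Q T₀ → Extend Λ Q n T₀ T →
                  All (_∈ Λ) T × AffIndep (map emb T)
  run-invariant frame init ext =
    let (T₀⊆Q , T₀⊆Λ) = init-sublist init in extend-invariant ext T₀⊆Λ (indep-sublist T₀⊆Q frame)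

  -- an independent tuple in Λ of maximal length spans Λ (stated
  -- doubly negated: appending a point outside the span would exceed it)
  maximal-spans : ∀ {d} {Λ : List (ZPt d)} {n} T → DimPlusOne Λ n → All (_∈ Λ) T → AffIndep (map emb T) →
                  length T ≡ n → ∀ x → x ∈ Λ → ¬ ¬ InSpanℤ T x
  maximal-spans T (_ , bound) T⊆Λ ind len x x∈ x∉ = ℕP.<-irrefl refl (ℕP.≤-trans
    (ℕP.≤-reflexive (trans (cong suc (sym len)) (trans (ℕP.+-comm 1 (length T)) (sym (LP.length-++ T)))))
    (bound (T ++ x ∷ []) (AllP.++⁺ T⊆Λ (x∈ ∷ [])) (indep-snocℤ T x ind x∉)))

open SingleRun

-- Steps 1 and 2 commute with φ ∈ Aff(d, ℤ): φ maps Y_d to itself,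
-- preserves dim Span(Λ), and a run on (φΛ, φQ) selects exactly the
-- images of the points selected on (Λ, Q), because φ transports spans
-- and coordinates unchanged.
module Equivariance {d} (φ : Aff d) where
  f : ZPt d → ZPt d
  f = actℤ φ

  g : QPt d → QPt d
  g = actℚ φ

  open Transport g (actℚ-affine φ)
  open Injective (actℚ-injective φ)

  emb-map : ∀ T → map emb (map f T) ≡ map g (map emb T)
  emb-map T = trans (sym (LP.map-∘ T)) (trans (LP.map-cong (emb-actℤ φ) T) (LP.map-∘ T))

  spanℤ-map : ∀ T p → InSpanℤ T p → InSpanℤ (map f T) (f p)
  spanℤ-map T p p∈ = subst₂ InSpan (sym (emb-map T)) (sym (emb-actℤ φ p)) (span-map (map emb T) (emb p) p∈)

  spanℤ-unmap : ∀ T p → InSpanℤ (map f T) (f p) → InSpanℤ T p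
  spanℤ-unmap T p fp∈ = span-unmap (map emb T) (emb p) (subst₂ InSpan (emb-map T) (emb-actℤ φ p) fp∈)

  indepℤ-map : ∀ T → AffIndep (map emb T) → AffIndep (map emb (map f T))
  indepℤ-map T ind = subst AffIndep (sym (emb-map T)) (indep-map (map emb T) ind)

  indepℤ-unmap : ∀ T → AffIndep (map emb (map f T)) → AffIndep (map emb T)
  indepℤ-unmap T ind = indep-unmap (map emb T) (subst AffIndep (emb-map T) ind)

  inY-map : ∀ Λ Q → InY Λ Q → InY (map f Λ) (map g Q)
  inY-map Λ Q (frame , Λ⊆span) = indep-map Q frame , λ z z∈ →
    let (x , x∈ , z≡fx) = ∈-map⁻ f z∈ in
    subst (InSpan (map g Q)) (sym (trans (cong emb z≡fx) (emb-actℤ φ x))) (span-map Q (emb x) (Λ⊆span x x∈))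

  preimage : ∀ Λ (W : List (ZPt d)) → All (_∈ map f Λ) W → Σ (List (ZPt d)) (λ V → All (_∈ Λ) V × map f V ≡ W)
  preimage Λ []      []         = [] , [] , refl
  preimage Λ (w ∷ W) (w∈ ∷ W⊆) =
    let (x , x∈ , w≡fx) = ∈-map⁻ f w∈ ; (V , V⊆ , fV≡W) = preimage Λ W W⊆ in
    x ∷ V , x∈ ∷ V⊆ , cong₂ _∷_ (sym w≡fx) fV≡W

  -- φ maps independent tuples in Λ to those in φΛ and back
  dim-invariant : ∀ Λ n n' → DimPlusOne Λ n → DimPlusOne (map f Λ) n' → n ≡ n'
  dim-invariant Λ n n' ((W , lenW , W⊆ , indW) , bound) ((W' , lenW' , W'⊆ , indW') , bound') = ℕP.≤-antisym
    (subst (ℕ._≤ n') (trans (LP.length-map f W) lenW) (bound' (map f W) (AllP.map⁺ (All.map (∈-map⁺ f) W⊆)) (indepℤ-map W indW)))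
    (let (V , V⊆ , fV≡W') = preimage Λ W' W'⊆ in
     subst (ℕ._≤ n) (trans (sym (LP.length-map f V)) (trans (cong length fV≡W') lenW'))
       (bound V V⊆ (indepℤ-unmap V (subst (λ X → AffIndep (map emb X)) (sym fV≡W') indW'))))

  init-map : ∀ Λ {Q T} → InitT Λ Q T → ∀ {Q' T'} → InitT (map f Λ) Q' T' → Q' ≡ map g Q → T' ≡ map f T
  init-map Λ init-[]            init-[]              _ = refl
  init-map Λ (init-keep z z∈ r) (init-keep z' _ r')  Q'≡ =
    cong₂ _∷_ (emb-injective z' (f z) (trans (LP.∷-injectiveˡ Q'≡) (sym (emb-actℤ φ z)))) (init-map Λ r r' (LP.∷-injectiveʳ Q'≡))
  init-map Λ (init-keep z z∈ r) (init-skip q z∉ r')  Q'≡ =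
    ⊥-elim (z∉ (f z , ∈-map⁺ f z∈ , trans (emb-actℤ φ z) (sym (LP.∷-injectiveˡ Q'≡))))
  init-map Λ (init-skip q q∉ r) (init-keep z' z'∈ r') Q'≡ =
    let (x , x∈ , z'≡fx) = ∈-map⁻ f z'∈ in
    ⊥-elim (q∉ (x , x∈ , actℚ-injective φ _ _ (trans (sym (emb-actℤ φ x)) (trans (cong emb (sym z'≡fx)) (LP.∷-injectiveˡ Q'≡)))))
  init-map Λ (init-skip q _ r)  (init-skip q' _ r')  Q'≡ = init-map Λ r r' (LP.∷-injectiveʳ Q'≡)

  LexLe-castL : ∀ {B C : Set} (h : B → C) qs (u u' : Vec ℚ (length qs)) → LexLe u u' → LexLe (castL h qs u) (castL h qs u')
  LexLe-castL h []       []       []        u≤u'                = u≤u'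
  LexLe-castL h (q ∷ qs) (x ∷ u) (y ∷ u') (inj₁ x<y)            = inj₁ x<y
  LexLe-castL h (q ∷ qs) (x ∷ u) (y ∷ u') (inj₂ (x≡y , u≤u'))   = inj₂ (x≡y , LexLe-castL h qs u u' u≤u')

  LexLe-castC : ∀ Q (u u' : Vec ℚ (coordLen Q)) → LexLe u u' → LexLe (castC g Q u) (castC g Q u')
  LexLe-castC []       u u' u≤u' = u≤u'
  LexLe-castC (q ∷ qs) u u' u≤u' = LexLe-castL g qs u u' u≤u'

  next-map : ∀ Λ Q T p → IsNext Λ Q T p → IsNext (map f Λ) (map g Q) (map f T) (f p)
  next-map Λ Q T p (p∈ , p∉ , p-min) = ∈-map⁺ f p∈ , (λ fp∈ → p∉ (spanℤ-unmap T p fp∈)) , fp-min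
    where
    fp-min : ∀ p' → p' ∈ map f Λ → ¬ InSpanℤ (map f T) p' → ∀ c c' →
             Coords (map g Q) (emb (f p)) c → Coords (map g Q) (emb p') c' → LexLe c c'
    fp-min p' p'∈ p'∉ c c' fp≡ p'≡ with ∈-map⁻ f p'∈
    ... | x , x∈ , refl =
      let u  = coords-unmap Q (emb p) c (subst (λ w → Coords (map g Q) w c) (emb-actℤ φ p) fp≡)
          u' = coords-unmap Q (emb x) c' (subst (λ w → Coords (map g Q) w c') (emb-actℤ φ x) p'≡)
          u≤u' = p-min x x∈ (λ x∈span → p'∉ (spanℤ-map T x x∈span)) _ _ u u'
      in subst₂ LexLe (castC-uncastC g Q c) (castC-uncastC g Q c') (LexLe-castC Q _ _ u≤u')

  extend-map : ∀ Λ Q → InY Λ Q → ∀ n {T T₁} → Extend Λ Q n T T₁ →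
               ∀ {T' T₁'} → Extend (map f Λ) (map g Q) n T' T₁' → T' ≡ map f T → T₁' ≡ map f T₁
  extend-map Λ Q y n (ext-done _) (ext-done _) T'≡ = T'≡
  extend-map Λ Q y n {T} (ext-done len) (ext-step _ short _ _) refl = ⊥-elim (ℕP.<-irrefl (trans (LP.length-map f T) len) short)
  extend-map Λ Q y n {T} (ext-step _ short _ _) (ext-done len') refl = ⊥-elim (ℕP.<-irrefl (trans (sym (LP.length-map f T)) len') short)
  extend-map Λ Q y n {T} (ext-step p _ next rest) (ext-step p' _ next' rest') refl =
    let p'≡fp = next-unique (map f Λ) (map g Q) (map f T) p' (f p) (proj₂ (inY-map Λ Q y)) next' (next-map Λ Q T p next)
    in extend-map Λ Q y n rest rest' (trans (cong (λ z → map f T ++ z ∷ []) p'≡fp) (sym (LP.map-++ f T (p ∷ []))))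

  run-map : ∀ Λ Q → InY Λ Q → ∀ {n n' T₀ T₀' T T'} → DimPlusOne Λ n → DimPlusOne (map f Λ) n' →
            InitT Λ Q T₀ → Extend Λ Q n T₀ T → InitT (map f Λ) (map g Q) T₀' → Extend (map f Λ) (map g Q) n' T₀' T' →
            T' ≡ map f T
  run-map Λ Q y {n} {n'} {T₀' = T₀'} {T' = T'} dim dim' init ext init' ext' =
    extend-map Λ Q y n ext (subst (λ m → Extend (map f Λ) (map g Q) m T₀' T') (sym (dim-invariant Λ n n' dim dim')) ext')
      (init-map Λ init init' refl)

module Normalisation where
  open import Data.Integer using (_+_; _-_; _≤_; _<_; 0ℤ)
  open import Data.Fin using (cast)
  open import Data.Rational.Solver using (module +-*-Solver)
  open +-*-Solver using (solve; _:+_; _:*_; _:-_; _:=_)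

  IsHNF-cong : ∀ {d k} {H H' : Mat d k} → (∀ i j → H i j ≡ H' i j) → IsHNF H → IsHNF H'
  IsHNF-cong H≗H' (r , r≤d , piv , mono , pos , left-zero , low-zero , reduced) =
    r , r≤d , piv , mono ,
    (λ i → subst (0ℤ <_) (H≗H' _ _) (pos i)) ,
    (λ i j j<p → trans (sym (H≗H' _ _)) (left-zero i j j<p)) ,
    (λ i j r≤i → trans (sym (H≗H' _ _)) (low-zero i j r≤i)) ,
    (λ i i' i<i' → let (0≤h , h<p) = reduced i i' i<i' in subst (0ℤ ≤_) (H≗H' _ _) 0≤h , subst₂ _<_ (H≗H' _ _) (H≗H' _ _) h<p)

  IsHNF-cast : ∀ {d k k'} (k≡k' : k ≡ k') (H : Mat d k') → IsHNF H → IsHNF (λ i j → H i (cast k≡k' j))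
  IsHNF-cast refl H = IsHNF-cong (λ i j → cong (H i) (sym (FinP.cast-is-id refl j)))

  castFin : ∀ {B C : Set} (h : B → C) (ps : List B) → Fin (length ps) → Fin (length (map h ps))
  castFin h (p ∷ ps) zero    = zero
  castFin h (p ∷ ps) (suc c) = suc (castFin h ps c)

  toℕ-castFin : ∀ {B C : Set} (h : B → C) ps c → toℕ (castFin h ps c) ≡ toℕ c
  toℕ-castFin h (p ∷ ps) zero    = refl
  toℕ-castFin h (p ∷ ps) (suc c) = cong suc (toℕ-castFin h ps c)

  lookup-castFin : ∀ {B C : Set} (h : B → C) ps c → L.lookup (map h ps) (castFin h ps c) ≡ h (L.lookup ps c)
  lookup-castFin h (p ∷ ps) zero    = refl
  lookup-castFin h (p ∷ ps) (suc c) = lookup-castFin h ps c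

  colComb : ∀ {d k} → Mat d k → Vec ℚ k → Fin d → ℚ
  colComb {k = k} M c r = sumFinℚ k (λ l → ι (M r l) ℚ.* lookup c l)

  affComb-colComb : ∀ {d} (p₀ : ZPt d) ps (c : Vec ℚ (length ps)) r →
    lookup (affComb (emb p₀) (map emb ps) (castL emb ps c)) r ≡ lookup (emb p₀) r ℚ.+ colComb (colMat p₀ ps) c r
  affComb-colComb p₀ []       []       r = sym (ℚP.+-identityʳ _)
  affComb-colComb p₀ (p ∷ ps) (c ∷ cs) r = begin
    lookup (affComb (emb p₀) (map emb (p ∷ ps)) (castL emb (p ∷ ps) (c ∷ cs))) r
      ≡⟨ lookup-step c (emb p) (emb p₀) _ r ⟩
    c ℚ.* (lookup (emb p) r ℚ.- lookup (emb p₀) r) ℚ.+ lookup (affComb (emb p₀) (map emb ps) (castL emb ps cs)) r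
      ≡⟨ cong₂ (λ u w → c ℚ.* u ℚ.+ w) column-p (affComb-colComb p₀ ps cs r) ⟩
    c ℚ.* ι (lookup p r ℤ.- lookup p₀ r) ℚ.+ (lookup (emb p₀) r ℚ.+ colComb (colMat p₀ ps) cs r)
      ≡⟨ solve 4 (λ c m e s → c :* m :+ (e :+ s) := e :+ (m :* c :+ s)) refl c (ι (lookup p r ℤ.- lookup p₀ r)) (lookup (emb p₀) r) _ ⟩
    lookup (emb p₀) r ℚ.+ colComb (colMat p₀ (p ∷ ps)) (c ∷ cs) r ∎
    where
    open ≡-Reasoning
    column-p : lookup (emb p) r ℚ.- lookup (emb p₀) r ≡ ι (lookup p r ℤ.- lookup p₀ r)
    column-p = trans (cong₂ ℚ._-_ (lookup-emb p r) (lookup-emb p₀ r))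
                     (sym (trans (ι-+ (lookup p r) (ℤ.- lookup p₀ r)) (cong (ι (lookup p r) ℚ.+_) (ι-neg (lookup p₀ r)))))

  ·ℚ-colComb : ∀ {d k} (A : Mat d d) (M : Mat d k) (w : QPt d) (c : Vec ℚ k) →
               (∀ r → lookup w r ≡ colComb M c r) → ∀ i → lookup (A ·ℚ w) i ≡ colComb (A ·M M) c i
  ·ℚ-colComb {d} {k} A M w c w≡ i = begin
    lookup (A ·ℚ w) i                                                         ≡⟨ lookup-·ℚ A w i ⟩
    sumFinℚ d (λ r → ι (A i r) ℚ.* lookup w r)                                ≡⟨ ΣQ.Σ-cong d (λ r → cong (ι (A i r) ℚ.*_) (w≡ r)) ⟩
    sumFinℚ d (λ r → ι (A i r) ℚ.* colComb M c r)                             ≡⟨ ΣQ.Σ-Σ-assoc d k (ι ∘ A i) (λ r l → ι (M r l)) (lookup c) ⟨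
    sumFinℚ k (λ l → sumFinℚ d (λ r → ι (A i r) ℚ.* ι (M r l)) ℚ.* lookup c l) ≡⟨ ΣQ.Σ-cong k (λ l → cong (ℚ._* lookup c l) entry) ⟩
    colComb (A ·M M) c i                                                      ∎
    where
    open ≡-Reasoning
    entry : ∀ {l} → sumFinℚ d (λ r → ι (A i r) ℚ.* ι (M r l)) ≡ ι ((A ·M M) i l)
    entry {l} = trans (ΣQ.Σ-cong d (λ r → sym (ι-* (A i r) (M r l)))) (sym (ι-Σ d _))

  agree-on-span : ∀ {d} (A A' : Mat d d) p₀ ps → (∀ r c → (A ·M colMat p₀ ps) r c ≡ (A' ·M colMat p₀ ps) r c) →
                  ∀ x → InSpanℤ (p₀ ∷ ps) x → A ·ℤ zipWith ℤ._-_ x p₀ ≡ A' ·ℤ zipWith ℤ._-_ x p₀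
  agree-on-span A A' p₀ ps AM≡A'M x (c , x≡) = emb-injective _ _ (begin
    emb (A ·ℤ v)    ≡⟨ emb-·ℤ A v ⟩
    A ·ℚ emb v      ≡⟨ lookup-ext (λ i → trans (·ℚ-colComb A M (emb v) c' v≡ i)
                         (trans (ΣQ.Σ-cong (length ps) (λ l → cong (λ z → ι z ℚ.* lookup c' l) (AM≡A'M i l)))
                                (sym (·ℚ-colComb A' M (emb v) c' v≡ i)))) ⟩
    A' ·ℚ emb v     ≡⟨ emb-·ℤ A' v ⟨
    emb (A' ·ℤ v)   ∎)
    where
    open ≡-Reasoning
    v : ZPt _
    v = zipWith ℤ._-_ x p₀
    M : Mat _ (length ps)
    M = colMat p₀ ps
    c' : Vec ℚ (length ps)
    c' = uncastL emb ps c
    x≡' : emb x ≡ affComb (emb p₀) (map emb ps) (castL emb ps c')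
    x≡' = trans x≡ (cong (affComb (emb p₀) (map emb ps)) (sym (castL-uncastL emb ps c)))
    v≡ : ∀ r → lookup (emb v) r ≡ colComb M c' r
    v≡ r = trans (cong (λ z → lookup z r) (emb-sub x p₀)) (trans (VP.lookup-zipWith ℚ._-_ r (emb x) (emb p₀))
      (trans (cong (ℚ._- lookup (emb p₀) r) (trans (cong (λ z → lookup z r) x≡') (affComb-colComb p₀ ps c' r)))
             (solve 2 (λ a s → (a :+ s) :- a := s) refl (lookup (emb p₀) r) (colComb M c' r))))

  colMat-map : ∀ {d} (φ : Aff d) p₀ ps r c →
               colMat (actℤ φ p₀) (map (actℤ φ) ps) r (castFin (actℤ φ) ps c) ≡ (Aff.A φ ·M colMat p₀ ps) r c
  colMat-map {d} φ p₀ ps r c = begin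
    lookup (L.lookup (map (actℤ φ) ps) (castFin (actℤ φ) ps c)) r ℤ.- lookup (actℤ φ p₀) r
      ≡⟨ cong (λ z → lookup z r ℤ.- lookup (actℤ φ p₀) r) (lookup-castFin (actℤ φ) ps c) ⟩
    lookup (actℤ φ p) r ℤ.- lookup (actℤ φ p₀) r
      ≡⟨ VP.lookup-zipWith ℤ._-_ r (actℤ φ p) (actℤ φ p₀) ⟨
    lookup (zipWith ℤ._-_ (actℤ φ p) (actℤ φ p₀)) r
      ≡⟨ cong (λ z → lookup z r) (actℤ-sub φ p p₀) ⟩
    lookup (Aff.A φ ·ℤ zipWith ℤ._-_ p p₀) r
      ≡⟨ lookup-·ℤ (Aff.A φ) (zipWith ℤ._-_ p p₀) r ⟩
    sumFin d (λ l → Aff.A φ r l ℤ.* lookup (zipWith ℤ._-_ p p₀) l)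
      ≡⟨ ΣZ.Σ-cong d (λ l → cong (Aff.A φ r l ℤ.*_) (VP.lookup-zipWith ℤ._-_ l p p₀)) ⟩
    (Aff.A φ ·M colMat p₀ ps) r c ∎
    where
    open ≡-Reasoning
    p : ZPt d
    p = L.lookup ps c

  cancel-inverse : ∀ {d k} (X B A : Mat d d) (Y : Mat d k) → (∀ i j → (B ·M A) i j ≡ idM i j) →
                   ∀ i j → ((X ·M B) ·M (A ·M Y)) i j ≡ (X ·M Y) i j
  cancel-inverse X B A Y BA≡1 i j =
    trans (·M-assoc X B (A ·M Y) i j)
          (·M-congʳ X (λ a b → trans (sym (·M-assoc B A Y a b)) (trans (·M-congˡ Y BA≡1 a b) (idM-·M Y a b))) i j)

  normalisers-agree : ∀ {d} (φ : Aff d) p₀ ps (A₁ A₂ : Mat d d) → InGL d A₁ → InGL d A₂ →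
    IsHNF (A₁ ·M colMat p₀ ps) → IsHNF (A₂ ·M colMat (actℤ φ p₀) (map (actℤ φ) ps)) →
    ∀ r c → (A₁ ·M colMat p₀ ps) r c ≡ ((A₂ ·M Aff.A φ) ·M colMat p₀ ps) r c
  normalisers-agree {d} φ p₀ ps A₁ A₂ gl₁ gl₂ hnf₁ hnf₂ r c =
    trans (hnf-unique H₁ H₂' U V hnf₁ (IsHNF-cast k≡ H₂ hnf₂) H₂'≡UH₁ H₁≡VH₂' r c)
          (trans (H₂'≡ r c) (sym (·M-assoc A₂ Aφ M r c)))
    where
    f : ZPt d → ZPt d
    f = actℤ φ
    Aφ : Mat d d
    Aφ = Aff.A φ
    M : Mat d (length ps)
    M = colMat p₀ ps
    H₁ : Mat d (length ps)
    H₁ = A₁ ·M M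
    H₂ : Mat d (length (map f ps))
    H₂ = A₂ ·M colMat (f p₀) (map f ps)
    k≡ : length ps ≡ length (map f ps)
    k≡ = sym (LP.length-map f ps)
    -- H₂ with its columns indexed like those of M
    H₂' : Mat d (length ps)
    H₂' i j = H₂ i (cast k≡ j)
    H₂'≡ : ∀ i j → H₂' i j ≡ (A₂ ·M (Aφ ·M M)) i j
    H₂'≡ i j = trans (cong (H₂ i) (FinP.toℕ-injective (trans (FinP.toℕ-cast k≡ j) (sym (toℕ-castFin f ps j)))))
                     (ΣZ.Σ-cong d (λ l → cong (A₂ i l ℤ.*_) (colMat-map φ p₀ ps l j)))
    -- H₂' = U H₁ and H₁ = V H₂', so uniqueness of the HNF applies
    U V : Mat d d
    U = (A₂ ·M Aφ) ·M inverse A₁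
    V = (A₁ ·M inverse Aφ) ·M inverse A₂
    H₂'≡UH₁ : ∀ i j → H₂' i j ≡ (U ·M H₁) i j
    H₂'≡UH₁ i j = trans (H₂'≡ i j)
      (sym (trans (cancel-inverse (A₂ ·M Aφ) (inverse A₁) A₁ M (inverse-left d A₁ gl₁) i j) (·M-assoc A₂ Aφ M i j)))
    H₁≡VH₂' : ∀ i j → H₁ i j ≡ (V ·M H₂') i j
    H₁≡VH₂' i j = sym (trans (·M-congʳ V H₂'≡ i j)
      (trans (cancel-inverse (A₁ ·M inverse Aφ) (inverse A₂) A₂ (Aφ ·M M) (inverse-left d A₂ gl₂) i j)
             (cancel-inverse A₁ (inverse Aφ) Aφ M (inverse-left d Aφ (Aff.A∈GL φ)) i j)))

  ψ : ∀ {d} → Mat d d → ZPt d → ZPt d → ZPt d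
  ψ A p₀ x = A ·ℤ zipWith ℤ._-_ x p₀

  -- hence ψ₁ = ψ₂ ∘ φ on Λ, which lies in the span of T (double
  -- negation is removed since equality of integer vectors is decidable)
  ψ-agree : ∀ {d} (φ : Aff d) (Λ : List (ZPt d)) p₀ ps (A₁ A₂ : Mat d d) →
    (∀ x → x ∈ Λ → ¬ ¬ InSpanℤ (p₀ ∷ ps) x) →
    (∀ r c → (A₁ ·M colMat p₀ ps) r c ≡ ((A₂ ·M Aff.A φ) ·M colMat p₀ ps) r c) →
    ∀ x → x ∈ Λ → ψ A₁ p₀ x ≡ ψ A₂ (actℤ φ p₀) (actℤ φ x)
  ψ-agree φ Λ p₀ ps A₁ A₂ Λ⊆span agree x x∈ with VP.≡-dec ℤP._≟_ (ψ A₁ p₀ x) (ψ A₂ (actℤ φ p₀) (actℤ φ x))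
  ... | yes same = same
  ... | no  differ = ⊥-elim (Λ⊆span x x∈ λ x∈span → differ (begin
    A₁ ·ℤ zipWith ℤ._-_ x p₀                       ≡⟨ agree-on-span A₁ (A₂ ·M Aff.A φ) p₀ ps agree x x∈span ⟩
    (A₂ ·M Aff.A φ) ·ℤ zipWith ℤ._-_ x p₀          ≡⟨ ·ℤ-·M A₂ (Aff.A φ) (zipWith ℤ._-_ x p₀) ⟩
    A₂ ·ℤ (Aff.A φ ·ℤ zipWith ℤ._-_ x p₀)          ≡⟨ cong (A₂ ·ℤ_) (actℤ-sub φ x p₀) ⟨
    A₂ ·ℤ zipWith ℤ._-_ (actℤ φ x) (actℤ φ p₀)     ∎))
    where open ≡-Reasoning

open Normalisation using (normalisers-agree; ψ; ψ-agree)

sameSet-≡ : ∀ {A : Set} {xs ys : List A} → xs ≡ ys → SameSet xs ys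
sameSet-≡ refl _ = id , id

cfwf-invariant : ∀ {d} (Λ : List (ZPt d)) Q → InY Λ Q → (φ : Aff d) → ∀ Λ₁ T₁ Λ₂ T₂ →
                 CFWF Λ Q Λ₁ T₁ → CFWF (map (actℤ φ) Λ) (map (actℚ φ) Q) Λ₂ T₂ → SameSet Λ₁ Λ₂ × T₁ ≡ T₂
cfwf-invariant Λ Q y φ ._ ._ ._ ._ (cfwf-empty _ _ _) (cfwf-empty _ _ _) = sameSet-≡ refl , refl
cfwf-invariant Λ Q y φ ._ ._ ._ ._ (cfwf-empty dim _ _) (cfwf p₀' ps' A₂ dim' _ ext' _ _) =
  ⊥-elim (ℕP.0≢1+n (trans (Equivariance.dim-invariant φ Λ _ _ dim dim') (sym (extend-length ext'))))
cfwf-invariant Λ Q y φ ._ ._ ._ ._ (cfwf p₀ ps A₁ dim _ ext _ _) (cfwf-empty dim' _ _) =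
  ⊥-elim (ℕP.0≢1+n (sym (trans (extend-length ext) (Equivariance.dim-invariant φ Λ _ _ dim dim'))))
cfwf-invariant {d} Λ Q y φ ._ ._ ._ ._ (cfwf p₀ ps A₁ dim init ext gl₁ hnf₁) (cfwf p₀' ps' A₂ dim' init' ext' gl₂ hnf₂) =
  compare (Equivariance.run-map φ Λ Q y dim dim' init ext init' ext') hnf₂
  where
  f : ZPt d → ZPt d
  f = actℤ φ
  T : List (ZPt d)
  T = p₀ ∷ ps
  T-props : All (_∈ Λ) T × AffIndep (map emb T)
  T-props = run-invariant (proj₁ y) init ext
  Λ⊆span : ∀ x → x ∈ Λ → ¬ ¬ InSpanℤ T x
  Λ⊆span = maximal-spans T dim (proj₁ T-props) (proj₂ T-props) (extend-length ext)
  compare : p₀' ∷ ps' ≡ map f T → IsHNF (A₂ ·M colMat p₀' ps') →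
            SameSet (map (ψ A₁ p₀) Λ) (map (ψ A₂ p₀') (map f Λ)) × map (ψ A₁ p₀) T ≡ map (ψ A₂ p₀') (p₀' ∷ ps')
  compare refl hnf₂ = sameSet-≡ Λ-images , T-images
    where
    agree : ∀ x → x ∈ Λ → ψ A₁ p₀ x ≡ ψ A₂ (f p₀) (f x)
    agree = ψ-agree φ Λ p₀ ps A₁ A₂ Λ⊆span (normalisers-agree φ p₀ ps A₁ A₂ gl₁ gl₂ hnf₁ hnf₂)
    Λ-images : map (ψ A₁ p₀) Λ ≡ map (ψ A₂ (f p₀)) (map f Λ)
    Λ-images = trans (LP.map-cong-local (All.tabulate (λ {x} → agree x))) (LP.map-∘ Λ)
    T-images : map (ψ A₁ p₀) T ≡ map (ψ A₂ (f p₀)) (map f T)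
    T-images = trans (LP.map-cong-local (All.map (λ {x} → agree x) (proj₁ T-props))) (LP.map-∘ T)

theorem3p2 : (d : ℕ) → .{{_ : NonZero d}} →
    (Λ : List (ZPt d)) (Q : List (QPt d)) → InY Λ Q → (φ : Aff d) →
    InY (map (actℤ φ) Λ) (map (actℚ φ) Q)
    × (∀ Λ₁ T₁ Λ₂ T₂ →
         CFWF Λ Q Λ₁ T₁ →
         CFWF (map (actℤ φ) Λ) (map (actℚ φ) Q) Λ₂ T₂ →
         SameSet Λ₁ Λ₂ × T₁ ≡ T₂)
theorem3p2 d Λ Q y φ = Equivariance.inY-map φ Λ Q y , cfwf-invariant Λ Q y φ
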